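{- For $h\ge1$ let $C_h(t,x,y)=\sum_G t^{\mathrm{ch}_h(G)}x^{\#H(G)}y^{\#U(G)}$, the sum over all bargraphs $G$. Then $$C_1=y\,\frac{1-x-y-xy+2t(1-t)x^2(1-y)-\sqrt{(1-y)(1-2x-y-2xy+x^2-x^2y)}}{2x\bigl(1-t+ty+(t^2-t)x(1-y)\bigr)},$$ and for every $h\ge2$, $$C_h=\frac{y}{x}\left(\frac{1}{1-x-xC_{h-1}}-1-x\right).$$
   Context: A bargraph is a lattice path with steps $U=(0,1)$, $H=(1,0)$, $D=(0,-1)$, identified with its word over $\{U,H,D\}$, that starts at the origin, ends on the $x$-axis, stays strictly above the $x$-axis except at its endpoints, and contains no two consecutive steps $UD$ or $DU$ (the empty path is not a bargraph). $\#H(G)$, $\#U(G)$ denote the numbers of $H$ and $U$ steps. Each $H$ step of $G$ is the top of a column whose height is the $y$-coordinate of that step; $\mathrm{ch}_h(G)$ is the number of columns of height $h$, i.e. the number of $H$ steps of $G$ at height $h$. -}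

module Defs where

open import Data.Nat as ℕ using (ℕ; zero; suc; _∸_)
open import Data.Integer as ℤ using (ℤ; +_)
open import Data.Bool using (Bool; true; false; _∧_; _∨_; not; if_then_else_)
open import Data.List using (List; []; _∷_; length; filter; concatMap; map)
open import Data.Maybe using (Maybe; just; nothing)
open import Relation.Binary.PropositionalEquality using (_≡_)
open import Relation.Nullary.Decidable using (does)
open import Data.Bool.Properties using (T?)

data Step : Set where
  U H D : Step

words : ℕ → List (List Step)
words zero    = [] ∷ []
words (suc n) = concatMap (λ w → (U ∷ w) ∷ (H ∷ w) ∷ (D ∷ w) ∷ []) (words n)

forbidden : Maybe Step → Step → Bool
forbidden (just U) D = true
forbidden (just D) U = true
forbidden _        _ = false

isPos : ℕ → Bool
isPos zero    = false
isPos (suc _) = true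

isZero : ℕ → Bool
isZero zero    = true
isZero (suc _) = false

isNil : List Step → Bool
isNil []      = true
isNil (_ ∷ _) = false

-- go h prev w : the path w, started at a vertex of height h whose previous
-- step was prev, never goes below the axis, has every vertex other than the
-- final one (and the initial vertex of the whole path) strictly above the
-- axis, has every H step strictly above the axis, contains no UD / DU, and
-- ends on the x-axis.
go : ℕ → Maybe Step → List Step → Bool
go h prev []      = isZero h
go h prev (U ∷ w) = not (forbidden prev U) ∧ go (suc h) (just U) w
go h prev (H ∷ w) = not (forbidden prev H) ∧ isPos h ∧ go h (just H) w
go zero prev (D ∷ w)    = false
go (suc h) prev (D ∷ w) = not (forbidden prev D) ∧ (isPos h ∨ isNil w) ∧ go h (just D) w

isBargraph : List Step → Bool
isBargraph []      = false
isBargraph (s ∷ w) = go 0 nothing (s ∷ w)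

#H : List Step → ℕ
#H []      = 0
#H (H ∷ w) = suc (#H w)
#H (_ ∷ w) = #H w

#U : List Step → ℕ
#U []      = 0
#U (U ∷ w) = suc (#U w)
#U (_ ∷ w) = #U w

chFrom : ℕ → ℕ → List Step → ℕ
chFrom h k []      = 0
chFrom h k (U ∷ w) = chFrom h (suc k) w
chFrom h k (D ∷ w) = chFrom h (k ∸ 1) w
chFrom h k (H ∷ w) = (if does (k ℕ.≟ h) then 1 else 0) ℕ.+ chFrom h k w

-- ch_h(G): number of columns of height h
ch : ℕ → List Step → ℕ
ch h w = chFrom h 0 w

_==_ : ℕ → ℕ → Bool
m == n = does (m ℕ.≟ n)

-- Formal power series in t, x, y with integer coefficients:
-- S a b c is the coefficient of t^a x^b y^c.

Series : Set
Series = ℕ → ℕ → ℕ → ℤ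

infix 4 _≈_
_≈_ : Series → Series → Set
f ≈ g = ∀ a b c → f a b c ≡ g a b c

const : ℤ → Series
const z zero zero zero = z
const z _    _    _    = + 0

tS xS yS : Series
tS (suc zero) zero zero = + 1
tS _ _ _ = + 0
xS zero (suc zero) zero = + 1
xS _ _ _ = + 0
yS zero zero (suc zero) = + 1
yS _ _ _ = + 0

infixl 6 _⊕_ _⊖_
infixl 7 _⊛_

_⊕_ : Series → Series → Series
(f ⊕ g) a b c = f a b c ℤ.+ g a b c

_⊖_ : Series → Series → Series
(f ⊖ g) a b c = f a b c ℤ.- g a b c

sumTo : ℕ → (ℕ → ℤ) → ℤ
sumTo zero    f = f 0
sumTo (suc n) f = sumTo n f ℤ.+ f (suc n)

_⊛_ : Series → Series → Series
(f ⊛ g) a b c =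
  sumTo a λ i → sumTo b λ j → sumTo c λ k →
    f i j k ℤ.* g (a ∸ i) (b ∸ j) (c ∸ k)

-- A bargraph with #H = b and #U = c has #D = c, hence length b + 2c,
-- so the bargraphs contributing to t^a x^b y^c are among the words of
-- length b + 2c.

C : ℕ → Series
C h a b c = + length (filter (λ w → T? (isBargraph w ∧ (#H w == b) ∧ (#U w == c) ∧ (ch h w == a)))
                             (words (b ℕ.+ 2 ℕ.* c)))

module Submission where

-- A bargraph is an up step followed by a path from height 1 back to the axis,
-- so C_h is y times the generating function of these tails. Splitting a tail at
-- its first step, and after an up step at its first return to height 1, gives
-- three equations for the tails entered by U, H and D (the entering step
-- matters because UD and DU are forbidden); above height 1 a column of height h
-- is a column of height h - 1 of a smaller tail. Eliminating the tails gives
--   C_h (1 - z - z C_(h-1)) = y ((1 + z) C_(h-1) + z),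
-- with z = t x for h = 1 and z = x otherwise. For h ≥ 2 this is the recurrence.

open import Algebra.Bundles using (CommutativeSemiring; CommutativeRing; CommutativeMonoid)
open import Level using (0ℓ)

module Summation (S : CommutativeSemiring 0ℓ 0ℓ) where

  open import Data.Nat as ℕ using (ℕ; zero; suc; _∸_; _≤_; z≤n; s≤s)
  import Data.Nat.Properties as ℕ
  open import Relation.Binary.PropositionalEquality as ≡ using (_≡_; _≢_)
  open import Relation.Nullary using (yes; no)

  open CommutativeSemiring S hiding (zero)
  open import Relation.Binary.Reasoning.Setoid setoid
  open import Algebra.Properties.CommutativeSemigroup
    (CommutativeMonoid.commutativeSemigroup +-commutativeMonoid) using (interchange)

  sum≤ : ℕ → (ℕ → Carrier) → Carrier
  sum≤ zero    f = f 0
  sum≤ (suc n) f = sum≤ n f + f (suc n)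

  syntax sum≤ n (λ i → e) = ∑[ i ≤ n ] e

  ≡⇒≈ : ∀ {x y} → x ≡ y → x ≈ y
  ≡⇒≈ ≡.refl = refl

  sum≤-cong : ∀ n {f g} → (∀ i → i ≤ n → f i ≈ g i) → sum≤ n f ≈ sum≤ n g
  sum≤-cong zero    f≈g = f≈g 0 z≤n
  sum≤-cong (suc n) f≈g =
    +-cong (sum≤-cong n (λ i i≤n → f≈g i (ℕ.m≤n⇒m≤1+n i≤n))) (f≈g (suc n) ℕ.≤-refl)

  sum≤-cong′ : ∀ n {f g} → (∀ i → f i ≈ g i) → sum≤ n f ≈ sum≤ n g
  sum≤-cong′ n f≈g = sum≤-cong n (λ i _ → f≈g i)

  sum≤-distrib-+ : ∀ n f g → ∑[ i ≤ n ] (f i + g i) ≈ sum≤ n f + sum≤ n g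
  sum≤-distrib-+ zero    f g = refl
  sum≤-distrib-+ (suc n) f g = begin
    ∑[ i ≤ n ] (f i + g i) + (f (suc n) + g (suc n))  ≈⟨ +-congʳ (sum≤-distrib-+ n f g) ⟩
    (sum≤ n f + sum≤ n g) + (f (suc n) + g (suc n))   ≈⟨ interchange _ _ _ _ ⟩
    (sum≤ n f + f (suc n)) + (sum≤ n g + g (suc n))   ∎

  sum≤-*ˡ : ∀ n c f → ∑[ i ≤ n ] (c * f i) ≈ c * sum≤ n f
  sum≤-*ˡ zero    c f = refl
  sum≤-*ˡ (suc n) c f = begin
    ∑[ i ≤ n ] (c * f i) + c * f (suc n)  ≈⟨ +-congʳ (sum≤-*ˡ n c f) ⟩
    c * sum≤ n f + c * f (suc n)          ≈⟨ distribˡ c _ _ ⟨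
    c * (sum≤ n f + f (suc n))            ∎

  sum≤-*ʳ : ∀ n c f → ∑[ i ≤ n ] (f i * c) ≈ sum≤ n f * c
  sum≤-*ʳ n c f = begin
    ∑[ i ≤ n ] (f i * c)  ≈⟨ sum≤-cong′ n (λ i → *-comm (f i) c) ⟩
    ∑[ i ≤ n ] (c * f i)  ≈⟨ sum≤-*ˡ n c f ⟩
    c * sum≤ n f          ≈⟨ *-comm c _ ⟩
    sum≤ n f * c          ∎

  sum≤-zero : ∀ n {f} → (∀ i → i ≤ n → f i ≈ 0#) → sum≤ n f ≈ 0#
  sum≤-zero zero    f≈0 = f≈0 0 z≤n
  sum≤-zero (suc n) f≈0 = begin
    _        ≈⟨ +-cong (sum≤-zero n (λ i i≤n → f≈0 i (ℕ.m≤n⇒m≤1+n i≤n))) (f≈0 (suc n) ℕ.≤-refl) ⟩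
    0# + 0#  ≈⟨ +-identityˡ 0# ⟩
    0#       ∎

  sum≤-suc : ∀ n f → sum≤ (suc n) f ≈ f 0 + ∑[ i ≤ n ] f (suc i)
  sum≤-suc zero    f = refl
  sum≤-suc (suc n) f = begin
    sum≤ (suc n) f + f (suc (suc n))                 ≈⟨ +-congʳ (sum≤-suc n f) ⟩
    (f 0 + ∑[ i ≤ n ] f (suc i)) + f (suc (suc n))  ≈⟨ +-assoc _ _ _ ⟩
    f 0 + (∑[ i ≤ n ] f (suc i) + f (suc (suc n)))  ∎

  sum≤-reverse : ∀ n f → sum≤ n f ≈ ∑[ i ≤ n ] f (n ∸ i)
  sum≤-reverse zero    f = refl
  sum≤-reverse (suc n) f = begin
    sum≤ (suc n) f                         ≈⟨ sum≤-suc n f ⟩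
    f 0 + ∑[ i ≤ n ] f (suc i)             ≈⟨ +-congˡ (sum≤-reverse n (λ i → f (suc i))) ⟩
    f 0 + ∑[ i ≤ n ] f (suc (n ∸ i))       ≈⟨ +-comm _ _ ⟩
    ∑[ i ≤ n ] f (suc (n ∸ i)) + f 0
      ≈⟨ +-cong (sum≤-cong n (λ i i≤n → ≡⇒≈ (≡.cong f (≡.sym (ℕ.+-∸-assoc 1 i≤n)))))
                (≡⇒≈ (≡.cong f (≡.sym (ℕ.n∸n≡0 n)))) ⟩
    ∑[ i ≤ n ] f (suc n ∸ i) + f (suc n ∸ suc n) ∎

  sum≤-*-sum≤ : ∀ m n f g → sum≤ m f * sum≤ n g ≈ ∑[ i ≤ m ] ∑[ j ≤ n ] (f i * g j)
  sum≤-*-sum≤ m n f g = begin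
    sum≤ m f * sum≤ n g                 ≈⟨ sum≤-*ʳ m (sum≤ n g) f ⟨
    ∑[ i ≤ m ] (f i * sum≤ n g)         ≈⟨ sum≤-cong′ m (λ i → sym (sum≤-*ˡ n (f i) g)) ⟩
    ∑[ i ≤ m ] ∑[ j ≤ n ] (f i * g j)   ∎

  sum≤-exchange : ∀ n a (F : ℕ → ℕ → Carrier) →
                  ∑[ m ≤ n ] sum≤ a (F m) ≈ ∑[ i ≤ a ] ∑[ m ≤ n ] F m i
  sum≤-exchange n zero    F = refl
  sum≤-exchange n (suc a) F = begin
    ∑[ m ≤ n ] (sum≤ a (F m) + F m (suc a))           ≈⟨ sum≤-distrib-+ n _ _ ⟩
    ∑[ m ≤ n ] sum≤ a (F m) + ∑[ m ≤ n ] F m (suc a)  ≈⟨ +-congʳ (sum≤-exchange n a F) ⟩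
    ∑[ i ≤ a ] ∑[ m ≤ n ] F m i + ∑[ m ≤ n ] F m (suc a) ∎

  sum≤-triangle : ∀ n (F : ℕ → ℕ → Carrier) →
    ∑[ i ≤ n ] ∑[ j ≤ i ] F j i ≈ ∑[ j ≤ n ] ∑[ k ≤ n ∸ j ] F j (j ℕ.+ k)
  sum≤-triangle zero    F = refl
  sum≤-triangle (suc n) F = begin
    ∑[ i ≤ n ] ∑[ j ≤ i ] F j i + (∑[ j ≤ n ] F j (suc n) + F (suc n) (suc n))
      ≈⟨ +-congʳ (sum≤-triangle n F) ⟩
    T + (∑[ j ≤ n ] F j (suc n) + F (suc n) (suc n))
      ≈⟨ +-assoc _ _ _ ⟨
    (T + ∑[ j ≤ n ] F j (suc n)) + F (suc n) (suc n)
      ≈⟨ +-cong (sum≤-distrib-+ n _ _) diagonal ⟨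
    ∑[ j ≤ n ] (∑[ k ≤ n ∸ j ] F j (j ℕ.+ k) + F j (suc n)) + ∑[ k ≤ n ∸ n ] F (suc n) (suc n ℕ.+ k)
      ≈⟨ +-congʳ (sum≤-cong n extend-row) ⟩
    ∑[ j ≤ n ] ∑[ k ≤ suc n ∸ j ] F j (j ℕ.+ k) + ∑[ k ≤ suc n ∸ suc n ] F (suc n) (suc n ℕ.+ k) ∎
    where
    T : Carrier
    T = ∑[ j ≤ n ] ∑[ k ≤ n ∸ j ] F j (j ℕ.+ k)
    diagonal : ∑[ k ≤ n ∸ n ] F (suc n) (suc n ℕ.+ k) ≈ F (suc n) (suc n)
    diagonal rewrite ℕ.n∸n≡0 n | ℕ.+-identityʳ n = refl
    extend-row : ∀ j → j ≤ n →
      ∑[ k ≤ n ∸ j ] F j (j ℕ.+ k) + F j (suc n) ≈ ∑[ k ≤ suc n ∸ j ] F j (j ℕ.+ k)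
    extend-row j j≤n rewrite ℕ.+-∸-assoc 1 j≤n = +-congˡ (≡⇒≈ (≡.cong (F j) last-column))
      where
      last-column : suc n ≡ j ℕ.+ suc (n ∸ j)
      last-column = ≡.sym (≡.trans (ℕ.+-suc j (n ∸ j)) (≡.cong suc (ℕ.m+[n∸m]≡n j≤n)))

  sum≤-single : ∀ n m {f} → m ≤ n → (∀ i → i ≤ n → i ≢ m → f i ≈ 0#) → sum≤ n f ≈ f m
  sum≤-single zero    .zero z≤n _ = refl
  sum≤-single (suc n) m {f} m≤1+n others with m ℕ.≟ suc n
  ... | yes ≡.refl = begin
    sum≤ n f + f (suc n)  ≈⟨ +-congʳ (sum≤-zero n (λ i i≤n → others i (ℕ.m≤n⇒m≤1+n i≤n) (ℕ.<⇒≢ (s≤s i≤n)))) ⟩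
    0# + f (suc n)        ≈⟨ +-identityˡ _ ⟩
    f (suc n)             ∎
  ... | no m≢1+n = begin
    sum≤ n f + f (suc n)  ≈⟨ +-cong (sum≤-single n m (ℕ.≤-pred (ℕ.≤∧≢⇒< m≤1+n m≢1+n))
                                                    (λ i i≤n → others i (ℕ.m≤n⇒m≤1+n i≤n)))
                                    (others (suc n) ℕ.≤-refl (λ e → m≢1+n (≡.sym e))) ⟩
    f m + 0#              ≈⟨ +-identityʳ _ ⟩
    f m                   ∎

module PowerSeries (R : CommutativeRing 0ℓ 0ℓ) where

  open import Data.Nat as ℕ using (ℕ; zero; suc; _∸_; _≤_; z≤n; s≤s)
  import Data.Nat.Properties as ℕ
  open import Data.Product using (_,_)
  open import Data.Sum using (inj₁; inj₂)
  open import Relation.Binary.PropositionalEquality as ≡ using (_≡_)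

  open CommutativeRing R hiding (zero)
  open import Relation.Binary.Reasoning.Setoid setoid
  open Summation commutativeSemiring

  PS : Set
  PS = ℕ → Carrier

  infix  4 _≈ₛ_
  infixl 6 _+ₛ_
  infixl 7 _*ₛ_

  _≈ₛ_ : PS → PS → Set
  f ≈ₛ g = ∀ n → f n ≈ g n

  _+ₛ_ _*ₛ_ : PS → PS → PS
  (f +ₛ g) n = f n + g n
  (f *ₛ g) n = ∑[ i ≤ n ] (f i * g (n ∸ i))

  -ₛ_ : PS → PS
  (-ₛ f) n = - f n

  0ₛ : PS
  0ₛ _ = 0#

  Cₛ : Carrier → PS
  Cₛ c zero    = c
  Cₛ c (suc _) = 0#

  Xₛ : PS
  Xₛ zero    = 0#
  Xₛ (suc n) = Cₛ 1# n

  *ₛ-cong : ∀ {f f′ g g′} → f ≈ₛ f′ → g ≈ₛ g′ → f *ₛ g ≈ₛ f′ *ₛ g′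
  *ₛ-cong f≈f′ g≈g′ n = sum≤-cong′ n (λ i → *-cong (f≈f′ i) (g≈g′ (n ∸ i)))

  *ₛ-comm : ∀ f g → f *ₛ g ≈ₛ g *ₛ f
  *ₛ-comm f g n = begin
    ∑[ i ≤ n ] (f i * g (n ∸ i))               ≈⟨ sum≤-reverse n _ ⟩
    ∑[ i ≤ n ] (f (n ∸ i) * g (n ∸ (n ∸ i)))
      ≈⟨ sum≤-cong n (λ i i≤n → trans (*-comm _ _) (*-congʳ (≡⇒≈ (≡.cong g (ℕ.m∸[m∸n]≡n i≤n))))) ⟩
    ∑[ i ≤ n ] (g i * f (n ∸ i))               ∎

  *ₛ-assoc : ∀ f g h → (f *ₛ g) *ₛ h ≈ₛ f *ₛ (g *ₛ h)
  *ₛ-assoc f g h n = begin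
    ∑[ i ≤ n ] (∑[ j ≤ i ] (f j * g (i ∸ j)) * h (n ∸ i))
      ≈⟨ sum≤-cong′ n (λ i → sym (sum≤-*ʳ i (h (n ∸ i)) _)) ⟩
    ∑[ i ≤ n ] ∑[ j ≤ i ] (f j * g (i ∸ j) * h (n ∸ i))
      ≈⟨ sum≤-triangle n (λ j i → f j * g (i ∸ j) * h (n ∸ i)) ⟩
    ∑[ j ≤ n ] ∑[ k ≤ n ∸ j ] (f j * g (j ℕ.+ k ∸ j) * h (n ∸ (j ℕ.+ k)))
      ≈⟨ sum≤-cong′ n (λ j → sum≤-cong′ (n ∸ j) (λ k → trans (*-assoc _ _ _)
           (*-congˡ (*-cong (≡⇒≈ (≡.cong g (ℕ.m+n∸m≡n j k)))
                            (≡⇒≈ (≡.cong h (≡.sym (ℕ.∸-+-assoc n j k)))))))) ⟩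
    ∑[ j ≤ n ] ∑[ k ≤ n ∸ j ] (f j * (g k * h (n ∸ j ∸ k)))
      ≈⟨ sum≤-cong′ n (λ j → sum≤-*ˡ (n ∸ j) (f j) _) ⟩
    ∑[ j ≤ n ] (f j * ∑[ k ≤ n ∸ j ] (g k * h (n ∸ j ∸ k))) ∎

  Cₛ-*ₛ : ∀ c f n → (Cₛ c *ₛ f) n ≈ c * f n
  Cₛ-*ₛ c f zero    = refl
  Cₛ-*ₛ c f (suc n) = begin
    sum≤ (suc n) (λ i → Cₛ c i * f (suc n ∸ i))   ≈⟨ sum≤-suc n _ ⟩
    c * f (suc n) + ∑[ i ≤ n ] (0# * f (n ∸ i))   ≈⟨ +-congˡ (sum≤-zero n (λ i _ → zeroˡ _)) ⟩
    c * f (suc n) + 0#                            ≈⟨ +-identityʳ _ ⟩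
    c * f (suc n)                                 ∎

  *ₛ-identityˡ : ∀ f → Cₛ 1# *ₛ f ≈ₛ f
  *ₛ-identityˡ f n = trans (Cₛ-*ₛ 1# f n) (*-identityˡ (f n))

  *ₛ-identityʳ : ∀ f → f *ₛ Cₛ 1# ≈ₛ f
  *ₛ-identityʳ f n = trans (*ₛ-comm f (Cₛ 1#) n) (*ₛ-identityˡ f n)

  *ₛ-distribˡ : ∀ f g h → f *ₛ (g +ₛ h) ≈ₛ f *ₛ g +ₛ f *ₛ h
  *ₛ-distribˡ f g h n = trans (sum≤-cong′ n (λ i → distribˡ _ _ _)) (sum≤-distrib-+ n _ _)

  *ₛ-distribʳ : ∀ f g h → (g +ₛ h) *ₛ f ≈ₛ g *ₛ f +ₛ h *ₛ f
  *ₛ-distribʳ f g h n = begin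
    ((g +ₛ h) *ₛ f) n        ≈⟨ *ₛ-comm (g +ₛ h) f n ⟩
    (f *ₛ (g +ₛ h)) n        ≈⟨ *ₛ-distribˡ f g h n ⟩
    (f *ₛ g) n + (f *ₛ h) n  ≈⟨ +-cong (*ₛ-comm f g n) (*ₛ-comm f h n) ⟩
    (g *ₛ f) n + (h *ₛ f) n  ∎

  powerSeriesRing : CommutativeRing 0ℓ 0ℓ
  powerSeriesRing = record
    { Carrier = PS
    ; _≈_ = _≈ₛ_
    ; _+_ = _+ₛ_
    ; _*_ = _*ₛ_
    ; -_ = -ₛ_
    ; 0# = 0ₛ
    ; 1# = Cₛ 1#
    ; isCommutativeRing = record
      { isRing = record
        { +-isAbelianGroup = record
          { isGroup = record
            { isMonoid = record
              { isSemigroup = record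
                { isMagma = record
                  { isEquivalence = record
                    { refl = λ _ → refl ; sym = λ e n → sym (e n) ; trans = λ e e′ n → trans (e n) (e′ n) }
                  ; ∙-cong = λ e e′ n → +-cong (e n) (e′ n) }
                ; assoc = λ f g h n → +-assoc (f n) (g n) (h n) }
              ; identity = (λ f n → +-identityˡ (f n)) , (λ f n → +-identityʳ (f n)) }
            ; inverse = (λ f n → -‿inverseˡ (f n)) , (λ f n → -‿inverseʳ (f n))
            ; ⁻¹-cong = λ e n → -‿cong (e n) }
          ; comm = λ f g n → +-comm (f n) (g n) }
        ; *-cong = *ₛ-cong
        ; *-assoc = *ₛ-assoc
        ; *-identity = *ₛ-identityˡ , *ₛ-identityʳ
        ; distrib = *ₛ-distribˡ , *ₛ-distribʳ }
      ; *-comm = *ₛ-comm }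
    }

  Xₛ-*ₛ-zero : ∀ f → (Xₛ *ₛ f) 0 ≈ 0#
  Xₛ-*ₛ-zero f = zeroˡ (f 0)

  Xₛ-*ₛ-suc : ∀ f n → (Xₛ *ₛ f) (suc n) ≈ f n
  Xₛ-*ₛ-suc f n = begin
    sum≤ (suc n) (λ i → Xₛ i * f (suc n ∸ i))   ≈⟨ sum≤-suc n _ ⟩
    0# * f (suc n) + (Cₛ 1# *ₛ f) n            ≈⟨ +-cong (zeroˡ _) (*ₛ-identityˡ f n) ⟩
    0# + f n                                   ≈⟨ +-identityˡ _ ⟩
    f n                                        ∎

  NonZeroDivisor : Carrier → Set
  NonZeroDivisor c = ∀ x → x * c ≈ 0# → x ≈ 0#

  -- The lowest non-vanishing coefficient of f would survive in f *ₛ g.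
  nonZeroDivisor-series : ∀ g → NonZeroDivisor (g 0) → ∀ f → f *ₛ g ≈ₛ 0ₛ → f ≈ₛ 0ₛ
  nonZeroDivisor-series g regular f fg≈0 n = vanish-upto n n ℕ.≤-refl
    where
    vanish-upto : ∀ n m → m ≤ n → f m ≈ 0#
    vanish-upto zero    .zero z≤n = regular (f 0) (fg≈0 0)
    vanish-upto (suc n) m   m≤1+n with ℕ.m≤n⇒m<n∨m≡n m≤1+n
    ... | inj₁ (s≤s m≤n) = vanish-upto n m m≤n
    ... | inj₂ ≡.refl    = regular (f (suc n)) (begin
      f (suc n) * g 0           ≈⟨ *-congˡ (≡⇒≈ (≡.cong g (≡.sym (ℕ.n∸n≡0 n)))) ⟩
      f (suc n) * g (n ∸ n)     ≈⟨ +-identityˡ _ ⟨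
      0# + f (suc n) * g (n ∸ n)
        ≈⟨ +-congʳ (sym (sum≤-zero n (λ i i≤n → trans (*-congʳ (vanish-upto n i i≤n)) (zeroˡ _)))) ⟩
      (f *ₛ g) (suc n)          ≈⟨ fg≈0 (suc n) ⟩
      0#                        ∎)

  sum≤-pointwise : ∀ n F k →
    Summation.sum≤ (CommutativeRing.commutativeSemiring powerSeriesRing) n F k ≡ ∑[ i ≤ n ] F i k
  sum≤-pointwise zero    F k = ≡.refl
  sum≤-pointwise (suc n) F k = ≡.cong (_+ F (suc n) k) (sum≤-pointwise n F k)

module TrivariateSeries where

  open import Defs
  open import Algebra.Bundles using (CommutativeRing)
  open import Level using (0ℓ)
  open import Data.Nat as ℕ using (ℕ; zero; suc)
  open import Data.Integer as ℤ using (ℤ; +_)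
  import Data.Integer.Properties as ℤ
  open import Data.Maybe using (Maybe; just; nothing)
  open import Data.Product using (_,_)
  open import Data.Sum using (inj₁; inj₂)
  open import Relation.Binary.PropositionalEquality as ≡ using (_≡_; _≢_)
  open import Relation.Nullary using (yes; no; contradiction)

  module R₁ = PowerSeries ℤ.+-*-commutativeRing
  module R₂ = PowerSeries R₁.powerSeriesRing
  module R₃ = PowerSeries R₂.powerSeriesRing

  module 𝕊 = CommutativeRing R₃.powerSeriesRing
  open import Relation.Binary.Reasoning.Setoid 𝕊.setoid

  sum≤≡sumTo : ∀ n f → Summation.sum≤ (CommutativeRing.commutativeSemiring ℤ.+-*-commutativeRing) n f ≡ sumTo n f
  sum≤≡sumTo zero    f = ≡.refl
  sum≤≡sumTo (suc n) f = ≡.cong (ℤ._+ f (suc n)) (sum≤≡sumTo n f)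

  sumTo-cong : ∀ n {f g : ℕ → ℤ} → (∀ i → f i ≡ g i) → sumTo n f ≡ sumTo n g
  sumTo-cong zero    f≡g = f≡g 0
  sumTo-cong (suc n) f≡g = ≡.cong₂ ℤ._+_ (sumTo-cong n f≡g) (f≡g (suc n))

  -- Series is ((ℤ[[y]])[[x]])[[t]], whose product is the Cauchy product ⊛.
  ⊛≈*ₛ : ∀ f g → f ⊛ g ≈ f R₃.*ₛ g
  ⊛≈*ₛ f g a b c = ≡.sym (≡.trans (sumₜ≡sumTo a _) (sumTo-cong a (λ i → ≡.trans (sumₓ≡sumTo b _)
                                (sumTo-cong b (λ j → sum≤≡sumTo c _)))))
    where
    sumₓ≡sumTo : ∀ n F → Summation.sum≤ _ n F c ≡ sumTo n (λ j → F j c)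
    sumₓ≡sumTo n F = ≡.trans (R₁.sum≤-pointwise n F c) (sum≤≡sumTo n _)
    sumₜ≡sumTo : ∀ n F → Summation.sum≤ _ n F b c ≡ sumTo n (λ i → F i b c)
    sumₜ≡sumTo n F = ≡.trans (≡.cong (λ s → s c) (R₂.sum≤-pointwise n F b)) (sumₓ≡sumTo n _)

  ⊛-cong : ∀ {f f′ g g′} → f ≈ f′ → g ≈ g′ → f ⊛ g ≈ f′ ⊛ g′
  ⊛-cong {f} {f′} {g} {g′} f≈f′ g≈g′ = begin
    f ⊛ g          ≈⟨ ⊛≈*ₛ f g ⟩
    f R₃.*ₛ g      ≈⟨ R₃.*ₛ-cong {f} {f′} {g} {g′} f≈f′ g≈g′ ⟩
    f′ R₃.*ₛ g′    ≈⟨ ⊛≈*ₛ f′ g′ ⟨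
    f′ ⊛ g′        ∎

  ⊛-comm : ∀ f g → f ⊛ g ≈ g ⊛ f
  ⊛-comm f g = begin
    f ⊛ g       ≈⟨ ⊛≈*ₛ f g ⟩
    f R₃.*ₛ g   ≈⟨ R₃.*ₛ-comm f g ⟩
    g R₃.*ₛ f   ≈⟨ ⊛≈*ₛ g f ⟨
    g ⊛ f       ∎

  ⊛-assoc : ∀ f g h → (f ⊛ g) ⊛ h ≈ f ⊛ (g ⊛ h)
  ⊛-assoc f g h = begin
    (f ⊛ g) ⊛ h              ≈⟨ ⊛≈*ₛ (f ⊛ g) h ⟩
    (f ⊛ g) R₃.*ₛ h          ≈⟨ R₃.*ₛ-cong {f ⊛ g} {_} {h} {h} (⊛≈*ₛ f g) 𝕊.refl ⟩
    (f R₃.*ₛ g) R₃.*ₛ h      ≈⟨ R₃.*ₛ-assoc f g h ⟩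
    f R₃.*ₛ (g R₃.*ₛ h)      ≈⟨ R₃.*ₛ-cong {f} {f} {g ⊛ h} {_} 𝕊.refl (⊛≈*ₛ g h) ⟨
    f R₃.*ₛ (g ⊛ h)          ≈⟨ ⊛≈*ₛ f (g ⊛ h) ⟨
    f ⊛ (g ⊛ h)              ∎

  ⊛-distribˡ : ∀ f g h → f ⊛ (g ⊕ h) ≈ f ⊛ g ⊕ f ⊛ h
  ⊛-distribˡ f g h = begin
    f ⊛ (g ⊕ h)                ≈⟨ ⊛≈*ₛ f (g ⊕ h) ⟩
    f R₃.*ₛ (g ⊕ h)            ≈⟨ R₃.*ₛ-distribˡ f g h ⟩
    f R₃.*ₛ g ⊕ f R₃.*ₛ h      ≈⟨ 𝕊.+-cong (⊛≈*ₛ f g) (⊛≈*ₛ f h) ⟨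
    f ⊛ g ⊕ f ⊛ h              ∎

  ⊛-distribʳ : ∀ f g h → (g ⊕ h) ⊛ f ≈ g ⊛ f ⊕ h ⊛ f
  ⊛-distribʳ f g h = begin
    (g ⊕ h) ⊛ f        ≈⟨ ⊛-comm (g ⊕ h) f ⟩
    f ⊛ (g ⊕ h)        ≈⟨ ⊛-distribˡ f g h ⟩
    f ⊛ g ⊕ f ⊛ h      ≈⟨ 𝕊.+-cong (⊛-comm f g) (⊛-comm f h) ⟩
    g ⊛ f ⊕ h ⊛ f      ∎

  const≈Cₛ : ∀ z → const z ≈ R₃.Cₛ (R₂.Cₛ (R₁.Cₛ z))
  const≈Cₛ z zero    zero    zero    = ≡.refl
  const≈Cₛ z zero    zero    (suc c) = ≡.refl
  const≈Cₛ z zero    (suc b) c       = ≡.refl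
  const≈Cₛ z (suc a) b       c       = ≡.refl

  const-⊛ : ∀ z f a b c → (const z ⊛ f) a b c ≡ z ℤ.* f a b c
  const-⊛ z f a b c = ≡.trans (⊛≈*ₛ (const z) f a b c)
    (≡.trans (R₃.*ₛ-cong {const z} {_} {f} {f} (const≈Cₛ z) 𝕊.refl a b c)
    (≡.trans (R₃.Cₛ-*ₛ _ f a b c) (≡.trans (R₂.Cₛ-*ₛ _ (f a) b c) (R₁.Cₛ-*ₛ z (f a b) c))))

  ⊛-identityˡ : ∀ f → const (+ 1) ⊛ f ≈ f
  ⊛-identityˡ f a b c = ≡.trans (const-⊛ (+ 1) f a b c) (ℤ.*-identityˡ (f a b c))

  ⊛-identityʳ : ∀ f → f ⊛ const (+ 1) ≈ f
  ⊛-identityʳ f = 𝕊.trans (⊛-comm f (const (+ 1))) (⊛-identityˡ f)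

  seriesRing : CommutativeRing 0ℓ 0ℓ
  seriesRing = record
    { Carrier = Series
    ; _≈_ = _≈_
    ; _+_ = _⊕_
    ; _*_ = _⊛_
    ; -_ = R₃.-ₛ_
    ; 0# = R₃.0ₛ
    ; 1# = const (+ 1)
    ; isCommutativeRing = record
      { isRing = record
        { +-isAbelianGroup = 𝕊.+-isAbelianGroup
        ; *-cong = ⊛-cong
        ; *-assoc = ⊛-assoc
        ; *-identity = ⊛-identityˡ , ⊛-identityʳ
        ; distrib = ⊛-distribˡ , ⊛-distribʳ }
      ; *-comm = ⊛-comm }
    }

  const-0 : const (+ 0) ≈ R₃.0ₛ
  const-0 zero    zero    zero    = ≡.refl
  const-0 zero    zero    (suc c) = ≡.refl
  const-0 zero    (suc b) c       = ≡.refl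
  const-0 (suc a) b       c       = ≡.refl

  const-+ : ∀ z z′ → const (z ℤ.+ z′) ≈ const z ⊕ const z′
  const-+ z z′ zero    zero    zero    = ≡.refl
  const-+ z z′ zero    zero    (suc c) = ≡.refl
  const-+ z z′ zero    (suc b) c       = ≡.refl
  const-+ z z′ (suc a) b       c       = ≡.refl

  const-neg : ∀ z → const (ℤ.- z) ≈ R₃.-ₛ const z
  const-neg z zero    zero    zero    = ≡.refl
  const-neg z zero    zero    (suc c) = ≡.refl
  const-neg z zero    (suc b) c       = ≡.refl
  const-neg z (suc a) b       c       = ≡.refl

  const-* : ∀ z z′ → const (z ℤ.* z′) ≈ const z ⊛ const z′
  const-* z z′ a b c = ≡.sym (≡.trans (const-⊛ z (const z′) a b c) (scale a b c))
    where
    scale : ∀ a b c → z ℤ.* const z′ a b c ≡ const (z ℤ.* z′) a b c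
    scale zero    zero    zero    = ≡.refl
    scale zero    zero    (suc c) = ℤ.*-zeroʳ z
    scale zero    (suc b) c       = ℤ.*-zeroʳ z
    scale (suc a) b       c       = ℤ.*-zeroʳ z

  module SeriesSolver where
    open import Algebra.Solver.Ring.AlmostCommutativeRing
      using (fromCommutativeRing; _-Raw-AlmostCommutative⟶_)

    const-homomorphism : CommutativeRing.rawRing ℤ.+-*-commutativeRing
                           -Raw-AlmostCommutative⟶ fromCommutativeRing seriesRing
    const-homomorphism = record
      { ⟦_⟧    = const
      ; +-homo = const-+
      ; *-homo = const-*
      ; -‿homo = const-neg
      ; 0-homo = const-0
      ; 1-homo = 𝕊.refl
      }

    const-≟ : ∀ z z′ → Maybe (const z ≈ const z′)
    const-≟ z z′ with z ℤ.≟ z′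
    ... | yes ≡.refl = just 𝕊.refl
    ... | no  _      = nothing

    open import Algebra.Solver.Ring _ (fromCommutativeRing seriesRing) const-homomorphism const-≟ public

  xS≈Cₛ : xS ≈ R₃.Cₛ R₂.Xₛ
  xS≈Cₛ zero    zero          c       = ≡.refl
  xS≈Cₛ zero    (suc zero)    zero    = ≡.refl
  xS≈Cₛ zero    (suc zero)    (suc c) = ≡.refl
  xS≈Cₛ zero    (suc (suc b)) c       = ≡.refl
  xS≈Cₛ (suc a) b             c       = ≡.refl

  yS≈Cₛ : yS ≈ R₃.Cₛ (R₂.Cₛ R₁.Xₛ)
  yS≈Cₛ zero    zero    zero          = ≡.refl
  yS≈Cₛ zero    zero    (suc zero)    = ≡.refl
  yS≈Cₛ zero    zero    (suc (suc c)) = ≡.refl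
  yS≈Cₛ zero    (suc b) c             = ≡.refl
  yS≈Cₛ (suc a) b       c             = ≡.refl

  tS≈Xₛ : tS ≈ R₃.Xₛ
  tS≈Xₛ zero          b       c       = ≡.refl
  tS≈Xₛ (suc zero)    zero    zero    = ≡.refl
  tS≈Xₛ (suc zero)    zero    (suc c) = ≡.refl
  tS≈Xₛ (suc zero)    (suc b) c       = ≡.refl
  tS≈Xₛ (suc (suc a)) b       c       = ≡.refl

  private
    tS⊛≈Xₛ*ₛ : ∀ F → tS ⊛ F ≈ R₃.Xₛ R₃.*ₛ F
    tS⊛≈Xₛ*ₛ F = 𝕊.trans (⊛≈*ₛ tS F) (R₃.*ₛ-cong {tS} {_} {F} {F} tS≈Xₛ 𝕊.refl)

    xS⊛-coeff : ∀ F a b c → (xS ⊛ F) a b c ≡ (R₂.Xₛ R₂.*ₛ F a) b c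
    xS⊛-coeff F a b c = ≡.trans (⊛≈*ₛ xS F a b c)
      (≡.trans (R₃.*ₛ-cong {xS} {_} {F} {F} xS≈Cₛ 𝕊.refl a b c) (R₃.Cₛ-*ₛ R₂.Xₛ F a b c))

    yS⊛-coeff : ∀ F a b c → (yS ⊛ F) a b c ≡ (R₁.Xₛ R₁.*ₛ F a b) c
    yS⊛-coeff F a b c = ≡.trans (⊛≈*ₛ yS F a b c)
      (≡.trans (R₃.*ₛ-cong {yS} {_} {F} {F} yS≈Cₛ 𝕊.refl a b c)
      (≡.trans (R₃.Cₛ-*ₛ _ F a b c) (R₂.Cₛ-*ₛ R₁.Xₛ (F a) b c)))

  tS⊛-zero : ∀ F b c → (tS ⊛ F) 0 b c ≡ + 0
  tS⊛-zero F b c = ≡.trans (tS⊛≈Xₛ*ₛ F 0 b c) (R₃.Xₛ-*ₛ-zero F b c)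

  tS⊛-suc : ∀ F a b c → (tS ⊛ F) (suc a) b c ≡ F a b c
  tS⊛-suc F a b c = ≡.trans (tS⊛≈Xₛ*ₛ F (suc a) b c) (R₃.Xₛ-*ₛ-suc F a b c)

  xS⊛-zero : ∀ F a c → (xS ⊛ F) a 0 c ≡ + 0
  xS⊛-zero F a c = ≡.trans (xS⊛-coeff F a 0 c) (R₂.Xₛ-*ₛ-zero (F a) c)

  xS⊛-suc : ∀ F a b c → (xS ⊛ F) a (suc b) c ≡ F a b c
  xS⊛-suc F a b c = ≡.trans (xS⊛-coeff F a (suc b) c) (R₂.Xₛ-*ₛ-suc (F a) b c)

  yS⊛-zero : ∀ F a b → (yS ⊛ F) a b 0 ≡ + 0
  yS⊛-zero F a b = ≡.trans (yS⊛-coeff F a b 0) (R₁.Xₛ-*ₛ-zero (F a b))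

  yS⊛-suc : ∀ F a b c → (yS ⊛ F) a b (suc c) ≡ F a b c
  yS⊛-suc F a b c = ≡.trans (yS⊛-coeff F a b (suc c)) (R₁.Xₛ-*ₛ-suc (F a b) c)

  ⊛-nonZeroDivisor : ∀ {F G} → G 0 0 0 ≢ + 0 → F ⊛ G ≈ R₃.0ₛ → F ≈ R₃.0ₛ
  ⊛-nonZeroDivisor {F} {G} G₀≢0 FG≈0 =
    R₃.nonZeroDivisor-series G (R₂.nonZeroDivisor-series (G 0) (R₁.nonZeroDivisor-series (G 0 0) ℤ-regular))
      F (𝕊.trans (𝕊.sym (⊛≈*ₛ F G)) FG≈0)
    where
    ℤ-regular : ∀ x → x ℤ.* G 0 0 0 ≡ + 0 → x ≡ + 0
    ℤ-regular x xG₀≡0 with ℤ.i*j≡0⇒i≡0∨j≡0 x xG₀≡0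
    ... | inj₁ x≡0  = x≡0
    ... | inj₂ G₀≡0 = contradiction G₀≡0 G₀≢0

module WordSums where

  open import Defs
  open import Data.Nat as ℕ using (ℕ; zero; suc; _+_; _*_; _∸_)
  import Data.Nat.Properties as ℕ
  open import Data.Bool using (Bool; true; false; _∧_)
  open import Data.Bool.Properties using (T?)
  open import Data.List using (List; []; _∷_; length; filter; concatMap; map; _++_)
  open import Data.Nat.ListAction using (sum)
  open import Relation.Binary.PropositionalEquality as ≡ using (_≡_; refl; cong; cong₂; sym; trans)
  open ≡.≡-Reasoning
  open import Data.Nat.Tactic.RingSolver using (solve-∀)
  open import Algebra.Properties.CommutativeSemigroup ℕ.+-commutativeSemigroup using (interchange)

  open Summation ℕ.+-*-commutativeSemiring public

  𝟙 : Bool → ℕ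
  𝟙 true  = 1
  𝟙 false = 0

  𝟙-∧ : ∀ a b → 𝟙 (a ∧ b) ≡ 𝟙 a * 𝟙 b
  𝟙-∧ true  b = sym (ℕ.+-identityʳ (𝟙 b))
  𝟙-∧ false b = refl

  sumWords : ℕ → (List Step → ℕ) → ℕ
  sumWords zero    f = f []
  sumWords (suc n) f = sumWords n (λ w → f (U ∷ w) + f (H ∷ w) + f (D ∷ w))

  sumWords-cong : ∀ n {f g} → (∀ w → f w ≡ g w) → sumWords n f ≡ sumWords n g
  sumWords-cong zero    f≡g = f≡g []
  sumWords-cong (suc n) f≡g =
    sumWords-cong n (λ w → cong₂ _+_ (cong₂ _+_ (f≡g (U ∷ w)) (f≡g (H ∷ w))) (f≡g (D ∷ w)))

  sumWords-distrib-+ : ∀ n f g → sumWords n (λ w → f w + g w) ≡ sumWords n f + sumWords n g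
  sumWords-distrib-+ zero    f g = refl
  sumWords-distrib-+ (suc n) f g = begin
    sumWords n (λ w → (f (U ∷ w) + g (U ∷ w)) + (f (H ∷ w) + g (H ∷ w)) + (f (D ∷ w) + g (D ∷ w)))
      ≡⟨ sumWords-cong n (λ w → regroup (f (U ∷ w)) (g (U ∷ w)) (f (H ∷ w)) (g (H ∷ w)) (f (D ∷ w)) (g (D ∷ w))) ⟩
    sumWords n (λ w → (f (U ∷ w) + f (H ∷ w) + f (D ∷ w)) + (g (U ∷ w) + g (H ∷ w) + g (D ∷ w)))
      ≡⟨ sumWords-distrib-+ n _ _ ⟩
    sumWords (suc n) f + sumWords (suc n) g ∎
    where
    regroup : ∀ a a′ b b′ c c′ → (a + a′) + (b + b′) + (c + c′) ≡ (a + b + c) + (a′ + b′ + c′)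
    regroup = solve-∀

  sumWords-*ˡ : ∀ n k f → sumWords n (λ w → k * f w) ≡ k * sumWords n f
  sumWords-*ˡ zero    k f = refl
  sumWords-*ˡ (suc n) k f =
    trans (sumWords-cong n (λ w → factor k (f (U ∷ w)) (f (H ∷ w)) (f (D ∷ w)))) (sumWords-*ˡ n k _)
    where
    factor : ∀ k a b c → k * a + k * b + k * c ≡ k * (a + b + c)
    factor = solve-∀

  sumWords-*ʳ : ∀ n k f → sumWords n (λ w → f w * k) ≡ sumWords n f * k
  sumWords-*ʳ n k f = begin
    sumWords n (λ w → f w * k)  ≡⟨ sumWords-cong n (λ w → ℕ.*-comm (f w) k) ⟩
    sumWords n (λ w → k * f w)  ≡⟨ sumWords-*ˡ n k f ⟩
    k * sumWords n f            ≡⟨ ℕ.*-comm k _ ⟩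
    sumWords n f * k            ∎

  sumWords-of-length : ∀ n {f} → (∀ w → length w ≡ n → f w ≡ 0) → sumWords n f ≡ 0
  sumWords-of-length zero    f≡0 = f≡0 [] refl
  sumWords-of-length (suc n) f≡0 = sumWords-of-length n (λ w ∣w∣≡n →
    cong₂ _+_ (cong₂ _+_ (f≡0 (U ∷ w) (cong suc ∣w∣≡n)) (f≡0 (H ∷ w) (cong suc ∣w∣≡n)))
              (f≡0 (D ∷ w) (cong suc ∣w∣≡n)))

  sumWords-zero : ∀ n {f} → (∀ w → f w ≡ 0) → sumWords n f ≡ 0
  sumWords-zero n f≡0 = sumWords-of-length n (λ w _ → f≡0 w)

  sumWords-sum≤ : ∀ n a (F : List Step → ℕ → ℕ) →
                  sumWords n (λ w → sum≤ a (F w)) ≡ ∑[ i ≤ a ] sumWords n (λ w → F w i)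
  sumWords-sum≤ n zero    F = refl
  sumWords-sum≤ n (suc a) F =
    trans (sumWords-distrib-+ n _ _) (cong (_+ sumWords n (λ w → F w (suc a))) (sumWords-sum≤ n a F))

  sumWords-words : ∀ n f → sumWords n f ≡ sum (map f (words n))
  sumWords-words zero    f = sym (ℕ.+-identityʳ (f []))
  sumWords-words (suc n) f = trans (sumWords-words n _) (sym (sum-map-concatMap (words n)))
    where
    sum-map-concatMap : ∀ ws → sum (map f (concatMap (λ w → (U ∷ w) ∷ (H ∷ w) ∷ (D ∷ w) ∷ []) ws))
                             ≡ sum (map (λ w → f (U ∷ w) + f (H ∷ w) + f (D ∷ w)) ws)
    sum-map-concatMap []       = refl
    sum-map-concatMap (w ∷ ws) = trans (regroup (f (U ∷ w)) (f (H ∷ w)) (f (D ∷ w)) _)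
                                       (cong (f (U ∷ w) + f (H ∷ w) + f (D ∷ w) +_) (sum-map-concatMap ws))
      where
      regroup : ∀ a b c r → a + (b + (c + r)) ≡ a + b + c + r
      regroup = solve-∀

  length-filter : ∀ (P : List Step → Bool) ws → length (filter (λ w → T? (P w)) ws) ≡ sum (map (λ w → 𝟙 (P w)) ws)
  length-filter P []       = refl
  length-filter P (w ∷ ws) with P w
  ... | true  = cong suc (length-filter P ws)
  ... | false = length-filter P ws

  count≡sumWords : ∀ (P : List Step → Bool) n →
                   length (filter (λ w → T? (P w)) (words n)) ≡ sumWords n (λ w → 𝟙 (P w))
  count≡sumWords P n = trans (length-filter P (words n)) (sym (sumWords-words n _))

  sumSplits : (List Step → List Step → ℕ) → List Step → ℕ
  sumSplits f []      = f [] []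
  sumSplits f (s ∷ w) = f [] (s ∷ w) + sumSplits (λ u v → f (s ∷ u) v) w

  sumSplits-cong : ∀ w {f g} → (∀ u v → f u v ≡ g u v) → sumSplits f w ≡ sumSplits g w
  sumSplits-cong []      f≡g = f≡g [] []
  sumSplits-cong (s ∷ w) f≡g = cong₂ _+_ (f≡g [] (s ∷ w)) (sumSplits-cong w (λ u v → f≡g (s ∷ u) v))

  sumSplits-distrib-+ : ∀ w f g → sumSplits (λ u v → f u v + g u v) w ≡ sumSplits f w + sumSplits g w
  sumSplits-distrib-+ []      f g = refl
  sumSplits-distrib-+ (s ∷ w) f g =
    trans (cong (f [] (s ∷ w) + g [] (s ∷ w) +_) (sumSplits-distrib-+ w (λ u v → f (s ∷ u) v) (λ u v → g (s ∷ u) v)))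
          (interchange (f [] (s ∷ w)) (g [] (s ∷ w)) _ _)

  sumSplits-zero : ∀ w {f} → (∀ u v → f u v ≡ 0) → sumSplits f w ≡ 0
  sumSplits-zero []      f≡0 = f≡0 [] []
  sumSplits-zero (s ∷ w) f≡0 = cong₂ _+_ (f≡0 [] (s ∷ w)) (sumSplits-zero w (λ u v → f≡0 (s ∷ u) v))

  sumSplits-*ʳ : ∀ w (f : List Step → List Step → ℕ) (g : List Step → ℕ) →
                 sumSplits (λ u v → f u v * g (u ++ v)) w ≡ sumSplits f w * g w
  sumSplits-*ʳ []      f g = refl
  sumSplits-*ʳ (s ∷ w) f g =
    trans (cong (f [] (s ∷ w) * g (s ∷ w) +_) (sumSplits-*ʳ w (λ u v → f (s ∷ u) v) (λ w′ → g (s ∷ w′))))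
          (sym (ℕ.*-distribʳ-+ (g (s ∷ w)) (f [] (s ∷ w)) _))

  sumWords-sumSplits : ∀ N (f : List Step → List Step → ℕ) →
    sumWords N (sumSplits f) ≡ ∑[ m ≤ N ] sumWords m (λ u → sumWords (N ∸ m) (f u))
  sumWords-sumSplits zero    f = refl
  sumWords-sumSplits (suc N) f = begin
    sumWords N (λ w → sumSplits f (U ∷ w) + sumSplits f (H ∷ w) + sumSplits f (D ∷ w))
      ≡⟨ sumWords-cong N (λ w → regroup (f [] (U ∷ w)) (f [] (H ∷ w)) (f [] (D ∷ w)) _ _ _) ⟩
    sumWords N (λ w → (f [] (U ∷ w) + f [] (H ∷ w) + f [] (D ∷ w))
                      + (sumSplits (f∷ U) w + sumSplits (f∷ H) w + sumSplits (f∷ D) w))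
      ≡⟨ sumWords-distrib-+ N _ _ ⟩
    sumWords (suc N) (f []) + sumWords N (λ w → sumSplits (f∷ U) w + sumSplits (f∷ H) w + sumSplits (f∷ D) w)
      ≡⟨ cong (sumWords (suc N) (f []) +_) (sumWords-cong N (λ w → sym (sumSplits-first-step w))) ⟩
    sumWords (suc N) (f []) + sumWords N (sumSplits f↑)
      ≡⟨ cong (sumWords (suc N) (f []) +_) (sumWords-sumSplits N f↑) ⟩
    sumWords (suc N) (f []) + ∑[ m ≤ N ] sumWords m (λ u → sumWords (N ∸ m) (f↑ u))
      ≡⟨ cong (sumWords (suc N) (f []) +_) (sum≤-cong N (λ m _ → sumWords-cong m (λ u → inner-sum u (N ∸ m)))) ⟩
    sumWords (suc N) (f []) + ∑[ m ≤ N ] sumWords (suc m) (λ u → sumWords (suc N ∸ suc m) (f u))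
      ≡⟨ sym (sum≤-suc N _) ⟩
    ∑[ m ≤ suc N ] sumWords m (λ u → sumWords (suc N ∸ m) (f u)) ∎
    where
    f∷ : Step → List Step → List Step → ℕ
    f∷ s u v = f (s ∷ u) v
    f↑ : List Step → List Step → ℕ
    f↑ u v = f∷ U u v + f∷ H u v + f∷ D u v
    sumSplits-first-step : ∀ w → sumSplits f↑ w ≡ sumSplits (f∷ U) w + sumSplits (f∷ H) w + sumSplits (f∷ D) w
    sumSplits-first-step w =
      trans (sumSplits-distrib-+ w _ _) (cong (_+ sumSplits (f∷ D) w) (sumSplits-distrib-+ w _ _))
    inner-sum : ∀ u n → sumWords n (f↑ u) ≡ sumWords n (f∷ U u) + sumWords n (f∷ H u) + sumWords n (f∷ D u)
    inner-sum u n =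
      trans (sumWords-distrib-+ n _ _) (cong (_+ sumWords n (f∷ D u)) (sumWords-distrib-+ n _ _))
    regroup : ∀ a b c d e f → a + d + (b + e) + (c + f) ≡ (a + b + c) + (d + e + f)
    regroup = solve-∀

module Paths where

  open import Defs
  open WordSums
  open import Data.Nat as ℕ using (ℕ; zero; suc; _+_; _*_; _∸_)
  import Data.Nat.Properties as ℕ
  open import Data.Bool using (true; false; _∧_; _∨_; not; if_then_else_)
  open import Data.List using (List; []; _∷_; length; _++_)
  open import Data.Maybe using (just)
  open import Relation.Binary.PropositionalEquality as ≡ using (_≡_; refl; cong; sym; trans)
  open import Data.Nat.Tactic.RingSolver using (solve-∀)

  -- The first-passage decomposition: a path from height k + j + 2 splits
  -- uniquely where it first reaches height j + 1, which it does by a D step.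
  go-first-passage : ∀ k j p w →
    𝟙 (go (suc k + suc j) p w) ≡ sumSplits (λ u v → 𝟙 (go (suc k) p u) * 𝟙 (go (suc j) (just D) v)) w
  go-first-passage k j p [] = refl
  go-first-passage k j p (U ∷ w) with not (forbidden p U)
  ... | true  = go-first-passage (suc k) j (just U) w
  ... | false = sym (sumSplits-zero w (λ u v → refl))
  go-first-passage k j p (H ∷ w) with not (forbidden p H)
  ... | true  = go-first-passage k j (just H) w
  ... | false = sym (sumSplits-zero w (λ u v → refl))
  go-first-passage (suc k) j p (D ∷ w) with not (forbidden p D)
  ... | true  = go-first-passage k j (just D) w
  ... | false = sym (sumSplits-zero w (λ u v → refl))
  go-first-passage zero j p (D ∷ []) with not (forbidden p D)
  ... | true  = refl
  ... | false = refl
  go-first-passage zero j p (D ∷ s ∷ w) with not (forbidden p D)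
  ... | true  = sym (trans (cong (𝟙 (go (suc j) (just D) (s ∷ w)) + 0 +_) (sumSplits-zero w (λ _ _ → refl)))
                           (trans (ℕ.+-identityʳ _) (ℕ.+-identityʳ _)))
  ... | false = sym (sumSplits-zero w (λ _ _ → refl))

  data Path : ℕ → List Step → Set where
    []   : Path 0 []
    U∷_  : ∀ {n w} → Path (suc n) w → Path n (U ∷ w)
    H∷_  : ∀ {n w} → Path (suc n) w → Path (suc n) (H ∷ w)
    D∷_  : ∀ {n w} → Path n w → Path (suc n) (D ∷ w)

  ∧-true-right : ∀ a {b} → a ∧ b ≡ true → b ≡ true
  ∧-true-right true b≡true = b≡true

  go⇒Path : ∀ n p w → go n p w ≡ true → Path n w
  go⇒Path zero    p []      _  = []
  go⇒Path n       p (U ∷ w) ok = U∷ go⇒Path (suc n) (just U) w (∧-true-right (not (forbidden p U)) ok)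
  go⇒Path (suc n) p (H ∷ w) ok =
    H∷ go⇒Path (suc n) (just H) w (∧-true-right (not (forbidden p H)) ok)
  go⇒Path (suc n) p (D ∷ w) ok =
    D∷ go⇒Path n (just D) w (∧-true-right (isPos n ∨ isNil w) (∧-true-right (not (forbidden p D)) ok))
  go⇒Path zero    p (H ∷ w) ok with not (forbidden p H) | ok
  ... | true  | ()
  ... | false | ()
  go⇒Path zero    p (D ∷ w) ()

  Path-length : ∀ {n w} → Path n w → length w ≡ #H w + #U w + #U w + n
  Path-length []        = refl
  Path-length (U∷_ {n} {w} p) = trans (cong suc (Path-length p)) (shuffle (#H w) (#U w) n)
    where
    shuffle : ∀ h u n → suc (h + u + u + suc n) ≡ h + suc u + suc u + n
    shuffle = solve-∀
  Path-length (H∷ p)    = cong suc (Path-length p)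
  Path-length (D∷_ {n} p) = trans (cong suc (Path-length p)) (sym (ℕ.+-suc _ n))

  #H-++ : ∀ u v → #H (u ++ v) ≡ #H u + #H v
  #H-++ []      v = refl
  #H-++ (U ∷ u) v = #H-++ u v
  #H-++ (H ∷ u) v = cong suc (#H-++ u v)
  #H-++ (D ∷ u) v = #H-++ u v

  #U-++ : ∀ u v → #U (u ++ v) ≡ #U u + #U v
  #U-++ []      v = refl
  #U-++ (U ∷ u) v = cong suc (#U-++ u v)
  #U-++ (H ∷ u) v = #U-++ u v
  #U-++ (D ∷ u) v = #U-++ u v

  endHeight : ℕ → List Step → ℕ
  endHeight k []      = k
  endHeight k (U ∷ w) = endHeight (suc k) w
  endHeight k (H ∷ w) = endHeight k w
  endHeight k (D ∷ w) = endHeight (k ∸ 1) w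

  chFrom-++ : ∀ h k u v → chFrom h k (u ++ v) ≡ chFrom h k u + chFrom h (endHeight k u) v
  chFrom-++ h k []      v = refl
  chFrom-++ h k (U ∷ u) v = chFrom-++ h (suc k) u v
  chFrom-++ h k (D ∷ u) v = chFrom-++ h (k ∸ 1) u v
  chFrom-++ h k (H ∷ u) v =
    trans (cong (_ +_) (chFrom-++ h k u v)) (sym (ℕ.+-assoc (if k ℕ.≡ᵇ h then 1 else 0) (chFrom h k u) _))

  Path-endHeight : ∀ {n w} k → Path n w → endHeight (n + k) w ≡ k
  Path-endHeight k []     = refl
  Path-endHeight k (U∷ p) = Path-endHeight k p
  Path-endHeight k (H∷ p) = Path-endHeight k p
  Path-endHeight k (D∷ p) = Path-endHeight k p

  -- At h = 0, where h ∸ 1 = 0, both sides vanish: no column of a path has height 0.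
  chFrom-lift : ∀ h {n w} → Path n w → chFrom h (suc n) w ≡ chFrom (h ∸ 1) n w
  chFrom-lift h       []     = refl
  chFrom-lift h       (U∷ p) = chFrom-lift h p
  chFrom-lift h       (D∷ p) = chFrom-lift h p
  chFrom-lift zero    (H∷ p) = chFrom-lift zero p
  chFrom-lift (suc h) (H∷ p) = cong (_ +_) (chFrom-lift (suc h) p)

module Convolution where

  open import Defs
  open WordSums
  open TrivariateSeries using (sumTo-cong)
  import Data.Integer as ℤ
  import Data.Integer.Properties as ℤ
  open import Data.Nat as ℕ using (ℕ; zero; suc; _+_; _*_; _∸_; _≤_; s≤s)
  import Data.Nat.Properties as ℕ
  open import Data.Bool using (Bool; true; false; T)
  open import Data.Unit using (tt)
  open import Data.List using (List; length)
  open import Relation.Binary.PropositionalEquality as ≡ using (_≡_; _≢_; refl; cong; cong₂; sym; trans)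
  open ≡.≡-Reasoning
  open import Relation.Nullary using (yes; no; contradiction)
  open import Data.Nat.Tactic.RingSolver using (solve-∀)

  𝟙-≢ : ∀ {x y} → x ≢ y → 𝟙 (x == y) ≡ 0
  𝟙-≢ {x} {y} x≢y with x ℕ.≡ᵇ y in x≡ᵇy
  ... | true  = contradiction (ℕ.≡ᵇ⇒≡ x y (≡.subst T (sym x≡ᵇy) tt)) x≢y
  ... | false = refl

  𝟙-+ : ∀ x y a → 𝟙 ((x + y) == a) ≡ ∑[ i ≤ a ] (𝟙 (x == i) * 𝟙 (y == (a ∸ i)))
  𝟙-+ zero    y zero    = sym (ℕ.+-identityʳ (𝟙 (y == 0)))
  𝟙-+ (suc x) y zero    = refl
  𝟙-+ zero    y (suc a) = sym (begin
    sum≤ (suc a) (λ i → 𝟙 (0 == i) * 𝟙 (y == (suc a ∸ i)))  ≡⟨ sum≤-suc a _ ⟩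
    𝟙 (y == suc a) + 0 + ∑[ i ≤ a ] 0                      ≡⟨ cong (𝟙 (y == suc a) + 0 +_) (sum≤-zero a (λ _ _ → refl)) ⟩
    𝟙 (y == suc a) + 0 + 0                                 ≡⟨ trans (ℕ.+-identityʳ _) (ℕ.+-identityʳ _) ⟩
    𝟙 (y == suc a)                                         ∎)
  𝟙-+ (suc x) y (suc a) = trans (𝟙-+ x y a) (sym (sum≤-suc a _))

  weight : (List Step → Bool) → (List Step → ℕ) → ℕ → ℕ → ℕ → List Step → ℕ
  weight P τ a b c w = 𝟙 (P w) * (𝟙 (τ w == a) * (𝟙 (#H w == b) * 𝟙 (#U w == c)))

  LengthDetermined : (List Step → Bool) → Set
  LengthDetermined P = ∀ w → P w ≡ true → length w ≡ #H w + #U w + #U w + 1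

  -- The generating function of the P-words, for LengthDetermined P: the only
  -- P-words with b H steps and c U steps have length b + 2c + 1.
  gf : (List Step → Bool) → (List Step → ℕ) → ℕ → ℕ → ℕ → ℕ
  gf P τ a b c = sumWords (suc (b + 2 * c)) (weight P τ a b c)

  infixl 7 _⊛ℕ_
  _⊛ℕ_ : (ℕ → ℕ → ℕ → ℕ) → (ℕ → ℕ → ℕ → ℕ) → ℕ → ℕ → ℕ → ℕ
  (F ⊛ℕ G) a b c = ∑[ i ≤ a ] ∑[ j ≤ b ] ∑[ k ≤ c ] (F i j k * G (a ∸ i) (b ∸ j) (c ∸ k))

  weight-off-length : ∀ {P} τ i j k → LengthDetermined P →
                      ∀ w → length w ≢ suc (j + 2 * k) → weight P τ i j k w ≡ 0
  weight-off-length {P} τ i j k P-length w ∣w∣≢ with P w in Pw | #H w ℕ.≟ j | #U w ℕ.≟ k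
  ... | false | _         | _         = refl
  ... | true  | yes ≡.refl | yes ≡.refl = contradiction (trans (P-length w Pw) (length-formula (#H w) (#U w))) ∣w∣≢
    where
    length-formula : ∀ j k → j + k + k + 1 ≡ suc (j + 2 * k)
    length-formula = solve-∀
  ... | true  | no  #H≢j  | _         =
    trans (cong (λ z → 𝟙 (τ w == i) * (z * 𝟙 (#U w == k)) + 0) (𝟙-≢ #H≢j))
          (vanishes (𝟙 (τ w == i)) (𝟙 (#U w == k)))
    where
    vanishes : ∀ a b → a * (0 * b) + 0 ≡ 0
    vanishes = solve-∀
  ... | true  | yes _     | no  #U≢k  =
    trans (cong (λ z → 𝟙 (τ w == i) * (𝟙 (#H w == j) * z) + 0) (𝟙-≢ #U≢k))
          (vanishes (𝟙 (τ w == i)) (𝟙 (#H w == j)))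
    where
    vanishes : ∀ a b → a * (b * 0) + 0 ≡ 0
    vanishes = solve-∀

  sumWords-sum≤³ : ∀ n a b c (F : List Step → ℕ → ℕ → ℕ → ℕ) →
    sumWords n (λ w → ∑[ i ≤ a ] ∑[ j ≤ b ] ∑[ k ≤ c ] F w i j k) ≡
    ∑[ i ≤ a ] ∑[ j ≤ b ] ∑[ k ≤ c ] sumWords n (λ w → F w i j k)
  sumWords-sum≤³ n a b c F = trans (sumWords-sum≤ n a _)
    (sum≤-cong′ a (λ i → trans (sumWords-sum≤ n b _) (sum≤-cong′ b (λ j → sumWords-sum≤ n c _))))

  sum≤-exchange³ : ∀ n a b c (F : ℕ → ℕ → ℕ → ℕ → ℕ) →
    ∑[ m ≤ n ] ∑[ i ≤ a ] ∑[ j ≤ b ] ∑[ k ≤ c ] F m i j k ≡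
    ∑[ i ≤ a ] ∑[ j ≤ b ] ∑[ k ≤ c ] ∑[ m ≤ n ] F m i j k
  sum≤-exchange³ n a b c F = trans (sum≤-exchange n a _)
    (sum≤-cong′ a (λ i → trans (sum≤-exchange n b _) (sum≤-cong′ b (λ j → sum≤-exchange n c _))))

  module _ (P Q : List Step → Bool) (τ₁ τ₂ : List Step → ℕ) where

    pairWeight : ℕ → ℕ → ℕ → List Step → List Step → ℕ
    pairWeight a b c u v = 𝟙 (P u) * 𝟙 (Q v) *
      (𝟙 ((τ₁ u + τ₂ v) == a) * (𝟙 ((#H u + #H v) == b) * 𝟙 ((#U u + #U v) == c)))

    pairWeight-product : ∀ a b c u v → pairWeight a b c u v ≡
      ∑[ i ≤ a ] ∑[ j ≤ b ] ∑[ k ≤ c ] (weight P τ₁ i j k u * weight Q τ₂ (a ∸ i) (b ∸ j) (c ∸ k) v)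
    pairWeight-product a b c u v = begin
      αβ * (𝟙 ((τ₁ u + τ₂ v) == a) * (𝟙 ((#H u + #H v) == b) * 𝟙 ((#U u + #U v) == c)))
        ≡⟨ cong₂ (λ x y → αβ * (x * y)) (𝟙-+ (τ₁ u) (τ₂ v) a) (cong₂ _*_ (𝟙-+ (#H u) (#H v) b) (𝟙-+ (#U u) (#U v) c)) ⟩
      αβ * (sum≤ a p * (sum≤ b r * sum≤ c s))
        ≡⟨ cong (λ z → αβ * (sum≤ a p * z)) (sum≤-*-sum≤ b c r s) ⟩
      αβ * (sum≤ a p * ∑[ j ≤ b ] ∑[ k ≤ c ] (r j * s k))
        ≡⟨ cong (αβ *_) (sum≤-*-sum≤ a b p _) ⟩
      αβ * ∑[ i ≤ a ] ∑[ j ≤ b ] (p i * ∑[ k ≤ c ] (r j * s k))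
        ≡⟨ sym (sum≤-*ˡ a αβ _) ⟩
      ∑[ i ≤ a ] (αβ * ∑[ j ≤ b ] (p i * ∑[ k ≤ c ] (r j * s k)))
        ≡⟨ sum≤-cong′ a (λ i → trans (sym (sum≤-*ˡ b αβ _)) (sum≤-cong′ b (λ j →
             trans (cong (αβ *_) (sym (sum≤-*ˡ c (p i) _))) (trans (sym (sum≤-*ˡ c αβ _))
               (sum≤-cong′ c (λ k → regroup (𝟙 (P u)) (𝟙 (Q v)) (𝟙 (τ₁ u == i)) (𝟙 (τ₂ v == (a ∸ i)))
                  (𝟙 (#H u == j)) (𝟙 (#H v == (b ∸ j))) (𝟙 (#U u == k)) (𝟙 (#U v == (c ∸ k))))))))) ⟩
      ∑[ i ≤ a ] ∑[ j ≤ b ] ∑[ k ≤ c ] (weight P τ₁ i j k u * weight Q τ₂ (a ∸ i) (b ∸ j) (c ∸ k) v) ∎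
      where
      αβ : ℕ
      αβ = 𝟙 (P u) * 𝟙 (Q v)
      p r s : ℕ → ℕ
      p = λ i → 𝟙 (τ₁ u == i) * 𝟙 (τ₂ v == (a ∸ i))
      r = λ j → 𝟙 (#H u == j) * 𝟙 (#H v == (b ∸ j))
      s = λ k → 𝟙 (#U u == k) * 𝟙 (#U v == (c ∸ k))
      regroup : ∀ α β p₁ p₂ r₁ r₂ s₁ s₂ →
        α * β * (p₁ * p₂ * (r₁ * r₂ * (s₁ * s₂))) ≡ (α * (p₁ * (r₁ * s₁))) * (β * (p₂ * (r₂ * s₂)))
      regroup = solve-∀

    -- For the pair (u, v) to contribute to t^i x^j y^k · t^(a-i) x^(b-j) y^(c-k),
    -- the prefix u must have length j + 2k + 1, so only one value of m survives.
    sum-prefix-lengths : LengthDetermined P → ∀ a b c i j k → j ≤ b → k ≤ c →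
      let N = suc (suc (b + 2 * c)) in
      ∑[ m ≤ N ] sumWords m (λ u → sumWords (N ∸ m) (λ v → weight P τ₁ i j k u * weight Q τ₂ (a ∸ i) (b ∸ j) (c ∸ k) v))
      ≡ gf P τ₁ i j k * gf Q τ₂ (a ∸ i) (b ∸ j) (c ∸ k)
    sum-prefix-lengths P-length a b c i j k j≤b k≤c = begin
      ∑[ m ≤ N ] sumWords m (λ u → sumWords (N ∸ m) (λ v → wP u * wQ v))
        ≡⟨ sum≤-single N m₀ m₀≤N other-lengths ⟩
      sumWords m₀ (λ u → sumWords (N ∸ m₀) (λ v → wP u * wQ v))
        ≡⟨ factorise m₀ (N ∸ m₀) ⟩
      sumWords m₀ wP * sumWords (N ∸ m₀) wQ
        ≡⟨ cong (λ n → sumWords m₀ wP * sumWords n wQ) suffix-length ⟩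
      gf P τ₁ i j k * gf Q τ₂ (a ∸ i) (b ∸ j) (c ∸ k) ∎
      where
      N m₀ : ℕ
      N = suc (suc (b + 2 * c))
      m₀ = suc (j + 2 * k)
      wP wQ : List Step → ℕ
      wP = weight P τ₁ i j k
      wQ = weight Q τ₂ (a ∸ i) (b ∸ j) (c ∸ k)
      factorise : ∀ m n → sumWords m (λ u → sumWords n (λ v → wP u * wQ v)) ≡ sumWords m wP * sumWords n wQ
      factorise m n = trans (sumWords-cong m (λ u → sumWords-*ˡ n (wP u) wQ)) (sumWords-*ʳ m _ wP)
      m₀≤N : m₀ ≤ N
      m₀≤N = s≤s (ℕ.m≤n⇒m≤1+n (ℕ.+-mono-≤ j≤b (ℕ.*-monoʳ-≤ 2 k≤c)))
      other-lengths : ∀ m → m ≤ N → m ≢ m₀ → sumWords m (λ u → sumWords (N ∸ m) (λ v → wP u * wQ v)) ≡ 0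
      other-lengths m _ m≢m₀ = trans (factorise m (N ∸ m)) (cong (_* sumWords (N ∸ m) wQ)
        (sumWords-of-length m (λ u ∣u∣≡m → weight-off-length τ₁ i j k P-length u (λ e → m≢m₀ (trans (sym ∣u∣≡m) e)))))
      split-length : ∀ j b′ k c′ → suc (suc ((j + b′) + 2 * (k + c′))) ≡ suc (j + 2 * k) + suc (b′ + 2 * c′)
      split-length = solve-∀
      suffix-length : N ∸ m₀ ≡ suc ((b ∸ j) + 2 * (c ∸ k))
      suffix-length = begin
        N ∸ m₀
          ≡⟨ cong₂ (λ b c → suc (suc (b + 2 * c)) ∸ m₀) (sym (ℕ.m+[n∸m]≡n j≤b)) (sym (ℕ.m+[n∸m]≡n k≤c)) ⟩
        suc (suc ((j + (b ∸ j)) + 2 * (k + (c ∸ k)))) ∸ m₀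
          ≡⟨ cong (_∸ m₀) (split-length j (b ∸ j) k (c ∸ k)) ⟩
        m₀ + suc ((b ∸ j) + 2 * (c ∸ k)) ∸ m₀
          ≡⟨ ℕ.m+n∸m≡n m₀ _ ⟩
        suc ((b ∸ j) + 2 * (c ∸ k)) ∎

    sumWords-concatenations : LengthDetermined P → ∀ a b c →
      sumWords (suc (suc (b + 2 * c))) (sumSplits (pairWeight a b c)) ≡ (gf P τ₁ ⊛ℕ gf Q τ₂) a b c
    sumWords-concatenations P-length a b c = begin
      sumWords N (sumSplits (pairWeight a b c))
        ≡⟨ sumWords-sumSplits N _ ⟩
      ∑[ m ≤ N ] sumWords m (λ u → sumWords (N ∸ m) (pairWeight a b c u))
        ≡⟨ sum≤-cong′ N (λ m → sumWords-cong m (λ u →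
             trans (sumWords-cong (N ∸ m) (pairWeight-product a b c u)) (sumWords-sum≤³ (N ∸ m) a b c _))) ⟩
      ∑[ m ≤ N ] sumWords m (λ u → ∑[ i ≤ a ] ∑[ j ≤ b ] ∑[ k ≤ c ] sumWords (N ∸ m) (W i j k u))
        ≡⟨ sum≤-cong′ N (λ m → sumWords-sum≤³ m a b c _) ⟩
      ∑[ m ≤ N ] ∑[ i ≤ a ] ∑[ j ≤ b ] ∑[ k ≤ c ] sumWords m (λ u → sumWords (N ∸ m) (W i j k u))
        ≡⟨ sum≤-exchange³ N a b c _ ⟩
      ∑[ i ≤ a ] ∑[ j ≤ b ] ∑[ k ≤ c ] ∑[ m ≤ N ] sumWords m (λ u → sumWords (N ∸ m) (W i j k u))
        ≡⟨ sum≤-cong a (λ i _ → sum≤-cong b (λ j j≤b → sum≤-cong c (λ k k≤c →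
             sum-prefix-lengths P-length a b c i j k j≤b k≤c))) ⟩
      (gf P τ₁ ⊛ℕ gf Q τ₂) a b c ∎
      where
      N : ℕ
      N = suc (suc (b + 2 * c))
      W : ℕ → ℕ → ℕ → List Step → List Step → ℕ
      W i j k u v = weight P τ₁ i j k u * weight Q τ₂ (a ∸ i) (b ∸ j) (c ∸ k) v

  lift : (ℕ → ℕ → ℕ → ℕ) → Series
  lift F a b c = ℤ.+ F a b c

  sumTo-lift : ∀ n f → sumTo n (λ i → ℤ.+ f i) ≡ ℤ.+ sum≤ n f
  sumTo-lift zero    f = refl
  sumTo-lift (suc n) f = cong (ℤ._+ ℤ.+ f (suc n)) (sumTo-lift n f)

  lift-⊛ℕ : ∀ F G → lift F ⊛ lift G ≈ lift (F ⊛ℕ G)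
  lift-⊛ℕ F G a b c =
    trans (sumTo-cong a (λ i → trans (sumTo-cong b (λ j → trans (sumTo-cong c (λ k → sym (ℤ.pos-* (F i j k) _)))
                                                                   (sumTo-lift c _)))
                                     (sumTo-lift b _)))
          (sumTo-lift a _)

module Recurrences where

  open import Defs
  open WordSums
  open Paths
  open Convolution
  open TrivariateSeries
  open import Data.Nat as ℕ using (ℕ; zero; suc; _+_; _*_; _∸_)
  import Data.Nat.Properties as ℕ
  open import Data.Integer as ℤ using (+_)
  open import Data.Bool using (Bool; true; false; _∧_)
  open import Data.List using (List; []; _∷_; _++_)
  open import Data.Maybe using (just)
  open import Relation.Binary.PropositionalEquality as ≡ using (_≡_; refl; cong; cong₂; sym; trans)
  open ≡.≡-Reasoning
  open import Data.Nat.Tactic.RingSolver using (solve-∀)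

  tailCount : ℕ → Step → ℕ → ℕ → ℕ → ℕ
  tailCount h p = gf (go 1 (just p)) (chFrom h 1)

  Tail : ℕ → Step → Series
  Tail h p = lift (tailCount h p)

  length-with-extra-U : ∀ b c → b + 2 * suc c ≡ suc (suc (b + 2 * c))
  length-with-extra-U = solve-∀

  -- An H step at height 1 contributes x, or t x when h = 1.
  H-step₁ : ℕ → Series
  H-step₁ 1 = tS ⊛ xS
  H-step₁ _ = xS

  tail-length : ∀ p → LengthDetermined (go 1 (just p))
  tail-length p w ok = Path-length (go⇒Path 1 (just p) w ok)

  tailCount-first-step : ∀ h p a b c → tailCount h p a b c ≡
    sumWords (b + 2 * c) (λ w → weight (go 1 (just p)) (chFrom h 1) a b c (U ∷ w)) +
    sumWords (b + 2 * c) (λ w → weight (go 1 (just p)) (chFrom h 1) a b c (H ∷ w)) +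
    sumWords (b + 2 * c) (λ w → weight (go 1 (just p)) (chFrom h 1) a b c (D ∷ w))
  tailCount-first-step h p a b c =
    trans (sumWords-distrib-+ (b + 2 * c) _ _)
          (cong (_+ sumWords (b + 2 * c) (λ w → W (D ∷ w))) (sumWords-distrib-+ (b + 2 * c) _ _))
    where
    W : List Step → ℕ
    W = weight (go 1 (just p)) (chFrom h 1) a b c

  U-term : ℕ → ℕ → ℕ → ℕ → ℕ
  U-term h a b c = sumWords (b + 2 * c) (λ w →
    𝟙 (go 2 (just U) w) * (𝟙 (chFrom h 2 w == a) * (𝟙 (#H w == b) * 𝟙 (suc (#U w) == c))))

  -- After the first U the path is at height 2; its first return to height 1
  -- cuts it into a tail entered by U (lifted by one, so its columns of height
  -- h are those of height h - 1 of the tail) and a tail entered by D.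
  U-term-concatenation : ∀ h a b c → U-term h a b (suc c) ≡ (tailCount (h ∸ 1) U ⊛ℕ tailCount h D) a b c
  U-term-concatenation h a b c = begin
    U-term h a b (suc c)
      ≡⟨ cong (λ n → sumWords n I) (length-with-extra-U b c) ⟩
    sumWords N I
      ≡⟨ sumWords-cong N split ⟩
    sumWords N (sumSplits (pairWeight P₁ P₂ τ₁ τ₂ a b c))
      ≡⟨ sumWords-concatenations P₁ P₂ τ₁ τ₂ (tail-length U) a b c ⟩
    (tailCount (h ∸ 1) U ⊛ℕ tailCount h D) a b c ∎
    where
    N : ℕ
    N = suc (suc (b + 2 * c))
    P₁ P₂ : List Step → Bool
    P₁ = go 1 (just U)
    P₂ = go 1 (just D)
    τ₁ τ₂ : List Step → ℕ
    τ₁ = chFrom (h ∸ 1) 1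
    τ₂ = chFrom h 1
    G : List Step → ℕ
    G w = 𝟙 (chFrom h 2 w == a) * (𝟙 (#H w == b) * 𝟙 (#U w == c))
    I : List Step → ℕ
    I w = 𝟙 (go 2 (just U) w) * G w
    statistics : ∀ u v → 𝟙 (P₁ u) * 𝟙 (P₂ v) * G (u ++ v) ≡ pairWeight P₁ P₂ τ₁ τ₂ a b c u v
    statistics u v with P₁ u in ok | P₂ v
    ... | false | _     = refl
    ... | true  | false = refl
    ... | true  | true  = cong (1 * 1 *_) (cong₂ (λ x y → 𝟙 (x == a) * y) ch-++
                            (cong₂ (λ x y → 𝟙 (x == b) * 𝟙 (y == c)) (#H-++ u v) (#U-++ u v)))
      where
      path : Path 1 u
      path = go⇒Path 1 (just U) u ok
      ch-++ : chFrom h 2 (u ++ v) ≡ τ₁ u + τ₂ v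
      ch-++ = trans (chFrom-++ h 2 u v)
                    (cong₂ _+_ (chFrom-lift h path) (cong (λ k → chFrom h k v) (Path-endHeight 1 path)))
    split : ∀ w → I w ≡ sumSplits (pairWeight P₁ P₂ τ₁ τ₂ a b c) w
    split w = begin
      𝟙 (go 2 (just U) w) * G w                           ≡⟨ cong (_* G w) (go-first-passage 0 0 (just U) w) ⟩
      sumSplits (λ u v → 𝟙 (P₁ u) * 𝟙 (P₂ v)) w * G w     ≡⟨ sym (sumSplits-*ʳ w _ G) ⟩
      sumSplits (λ u v → 𝟙 (P₁ u) * 𝟙 (P₂ v) * G (u ++ v)) w ≡⟨ sumSplits-cong w statistics ⟩
      sumSplits (pairWeight P₁ P₂ τ₁ τ₂ a b c) w            ∎

  U-term≡ : ∀ h a b c → + U-term h a b c ≡ (yS ⊛ (Tail (h ∸ 1) U ⊛ Tail h D)) a b c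
  U-term≡ h a b zero = trans
    (cong +_ (sumWords-zero (b + 0) (λ w → vanishes (𝟙 (go 2 (just U) w)) (𝟙 (chFrom h 2 w == a)) (𝟙 (#H w == b)))))
    (sym (yS⊛-zero (Tail (h ∸ 1) U ⊛ Tail h D) a b))
    where
    vanishes : ∀ x y z → x * (y * (z * 0)) ≡ 0
    vanishes = solve-∀
  U-term≡ h a b (suc c) = begin
    + U-term h a b (suc c)                                ≡⟨ cong +_ (U-term-concatenation h a b c) ⟩
    lift (tailCount (h ∸ 1) U ⊛ℕ tailCount h D) a b c    ≡⟨ sym (lift-⊛ℕ (tailCount (h ∸ 1) U) (tailCount h D) a b c) ⟩
    (Tail (h ∸ 1) U ⊛ Tail h D) a b c                    ≡⟨ sym (yS⊛-suc (Tail (h ∸ 1) U ⊛ Tail h D) a b c) ⟩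
    (yS ⊛ (Tail (h ∸ 1) U ⊛ Tail h D)) a b (suc c)       ∎

  H-term : ℕ → ℕ → ℕ → ℕ → ℕ
  H-term h a b c = sumWords (b + 2 * c) (λ w → weight (go 1 (just H)) (chFrom h 1) a b c (H ∷ w))

  -- H-term, when the first H step is not a column of height h.
  H-term-unmarked : ∀ h a b c →
    + sumWords (b + 2 * c) (λ w →
        𝟙 (go 1 (just H) w) * (𝟙 (chFrom h 1 w == a) * (𝟙 (suc (#H w) == b) * 𝟙 (#U w == c))))
    ≡ (xS ⊛ Tail h H) a b c
  H-term-unmarked h a zero    c = trans
    (cong +_ (sumWords-zero (2 * c) (λ w → vanishes (𝟙 (go 1 (just H) w)) (𝟙 (chFrom h 1 w == a)) (𝟙 (#U w == c)))))
    (sym (xS⊛-zero (Tail h H) a c))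
    where
    vanishes : ∀ x y z → x * (y * (0 * z)) ≡ 0
    vanishes = solve-∀
  H-term-unmarked h a (suc b) c = sym (xS⊛-suc (Tail h H) a b c)

  H-term≡ : ∀ h a b c → + H-term h a b c ≡ (H-step₁ h ⊛ Tail h H) a b c
  H-term≡ 0             = H-term-unmarked 0
  H-term≡ (suc (suc h)) = H-term-unmarked (suc (suc h))
  H-term≡ 1 zero    b c = begin
    + H-term 1 0 b c
      ≡⟨ cong +_ (sumWords-zero (b + 2 * c) (λ w → ℕ.*-zeroʳ (𝟙 (go 1 (just H) w)))) ⟩
    + 0                              ≡⟨ sym (tS⊛-zero (xS ⊛ Tail 1 H) b c) ⟩
    (tS ⊛ (xS ⊛ Tail 1 H)) 0 b c     ≡⟨ sym (⊛-assoc tS xS (Tail 1 H) 0 b c) ⟩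
    (tS ⊛ xS ⊛ Tail 1 H) 0 b c       ∎
  H-term≡ 1 (suc a) b c = begin
    + H-term 1 (suc a) b c             ≡⟨ H-term-unmarked 1 a b c ⟩
    (xS ⊛ Tail 1 H) a b c              ≡⟨ sym (tS⊛-suc (xS ⊛ Tail 1 H) a b c) ⟩
    (tS ⊛ (xS ⊛ Tail 1 H)) (suc a) b c ≡⟨ sym (⊛-assoc tS xS (Tail 1 H) (suc a) b c) ⟩
    (tS ⊛ xS ⊛ Tail 1 H) (suc a) b c   ∎

  D-term : ℕ → ℕ → ℕ → ℕ → ℕ
  D-term h a b c = sumWords (b + 2 * c) (λ w → weight (go 1 (just D)) (chFrom h 1) a b c (D ∷ w))

  -- Only the single step D returns from height 1 after a D step.
  D-term≡ : ∀ h a b c → + D-term h a b c ≡ const (+ 1) a b c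
  D-term≡ h zero    zero    zero    = refl
  D-term≡ h (suc a) zero    zero    = refl
  D-term≡ h zero    (suc b) c       = cong +_ (sumWords-zero (b + 2 * c) (λ w → refl))
  D-term≡ h (suc a) (suc b) c       = cong +_ (sumWords-zero (b + 2 * c) (λ w → refl))
  D-term≡ h zero    zero    (suc c) = cong +_ (sumWords-zero (c + 1 * suc c) (λ w → refl))
  D-term≡ h (suc a) zero    (suc c) = cong +_ (sumWords-zero (c + 1 * suc c) (λ w → refl))

  Tail-U : ∀ h → Tail h U ≈ yS ⊛ (Tail (h ∸ 1) U ⊛ Tail h D) ⊕ H-step₁ h ⊛ Tail h H
  Tail-U h a b c = begin
    + tailCount h U a b c
      ≡⟨ cong +_ (tailCount-first-step h U a b c) ⟩
    + (U-term h a b c + H-term h a b c + sumWords (b + 2 * c) (λ _ → 0))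
      ≡⟨ cong (λ z → + (U-term h a b c + H-term h a b c + z)) (sumWords-zero (b + 2 * c) (λ _ → refl)) ⟩
    + (U-term h a b c + H-term h a b c + 0)
      ≡⟨ cong +_ (ℕ.+-identityʳ _) ⟩
    + U-term h a b c ℤ.+ + H-term h a b c
      ≡⟨ cong₂ ℤ._+_ (U-term≡ h a b c) (H-term≡ h a b c) ⟩
    (yS ⊛ (Tail (h ∸ 1) U ⊛ Tail h D) ⊕ H-step₁ h ⊛ Tail h H) a b c ∎

  Tail-H : ∀ h → Tail h H ≈ yS ⊛ (Tail (h ∸ 1) U ⊛ Tail h D) ⊕ H-step₁ h ⊛ Tail h H ⊕ const (+ 1)
  Tail-H h a b c = trans (cong +_ (tailCount-first-step h H a b c))
    (cong₂ ℤ._+_ (cong₂ ℤ._+_ (U-term≡ h a b c) (H-term≡ h a b c)) (D-term≡ h a b c))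

  Tail-D : ∀ h → Tail h D ≈ H-step₁ h ⊛ Tail h H ⊕ const (+ 1)
  Tail-D h a b c = begin
    + tailCount h D a b c
      ≡⟨ cong +_ (tailCount-first-step h D a b c) ⟩
    + (sumWords (b + 2 * c) (λ _ → 0) + H-term h a b c + D-term h a b c)
      ≡⟨ cong (λ z → + (z + H-term h a b c + D-term h a b c)) (sumWords-zero (b + 2 * c) (λ _ → refl)) ⟩
    + H-term h a b c ℤ.+ + D-term h a b c
      ≡⟨ cong₂ ℤ._+_ (H-term≡ h a b c) (D-term≡ h a b c) ⟩
    (H-step₁ h ⊛ Tail h H ⊕ const (+ 1)) a b c ∎

  isBargraphWith : ℕ → ℕ → ℕ → ℕ → List Step → Bool
  isBargraphWith h a b c w = isBargraph w ∧ (#H w == b) ∧ (#U w == c) ∧ (ch h w == a)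

  bargraph-first-step : ∀ h a b c w →
    𝟙 (isBargraphWith h a b (suc c) (U ∷ w)) + 𝟙 (isBargraphWith h a b (suc c) (H ∷ w))
      + 𝟙 (isBargraphWith h a b (suc c) (D ∷ w))
    ≡ weight (go 1 (just U)) (chFrom h 1) a b c w
  bargraph-first-step h a b c w = begin
    𝟙 (p ∧ q ∧ r ∧ s) + 0 + 0             ≡⟨ trans (ℕ.+-identityʳ _) (ℕ.+-identityʳ _) ⟩
    𝟙 (p ∧ q ∧ r ∧ s)                     ≡⟨ 𝟙-∧ p _ ⟩
    𝟙 p * 𝟙 (q ∧ r ∧ s)                   ≡⟨ cong (𝟙 p *_) (trans (𝟙-∧ q _) (cong (𝟙 q *_) (𝟙-∧ r s))) ⟩
    𝟙 p * (𝟙 q * (𝟙 r * 𝟙 s))             ≡⟨ regroup (𝟙 p) (𝟙 q) (𝟙 r) (𝟙 s) ⟩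
    𝟙 p * (𝟙 s * (𝟙 q * 𝟙 r))             ∎
    where
    p q r s : Bool
    p = go 1 (just U) w
    q = #H w == b
    r = #U w == c
    s = chFrom h 1 w == a
    regroup : ∀ p q r s → p * (q * (r * s)) ≡ p * (s * (q * r))
    regroup = solve-∀

  C≈yS⊛Tail : ∀ h → C h ≈ yS ⊛ Tail h U
  C≈yS⊛Tail h a b zero = begin
    C h a b 0                                               ≡⟨ cong +_ (count≡sumWords (isBargraphWith h a b 0) (b + 0)) ⟩
    + sumWords (b + 0) (λ w → 𝟙 (isBargraphWith h a b 0 w))  ≡⟨ cong +_ (sumWords-zero (b + 0) no-U-step) ⟩
    + 0                                                     ≡⟨ sym (yS⊛-zero (Tail h U) a b) ⟩
    (yS ⊛ Tail h U) a b 0                                   ∎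
    where
    no-U-step : ∀ w → 𝟙 (isBargraphWith h a b 0 w) ≡ 0
    no-U-step []      = refl
    no-U-step (U ∷ w) with go 1 (just U) w | #H w == b
    ... | false | _     = refl
    ... | true  | false = refl
    ... | true  | true  = refl
    no-U-step (H ∷ w) = refl
    no-U-step (D ∷ w) = refl
  C≈yS⊛Tail h a b (suc c) = begin
    C h a b (suc c)
      ≡⟨ cong +_ (count≡sumWords (isBargraphWith h a b (suc c)) (b + 2 * suc c)) ⟩
    + sumWords (b + 2 * suc c) (λ w → 𝟙 (isBargraphWith h a b (suc c) w))
      ≡⟨ cong (λ n → + sumWords n (λ w → 𝟙 (isBargraphWith h a b (suc c) w))) (length-with-extra-U b c) ⟩
    + sumWords (suc (suc (b + 2 * c))) (λ w → 𝟙 (isBargraphWith h a b (suc c) w))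
      ≡⟨ cong +_ (sumWords-cong (suc (b + 2 * c)) (bargraph-first-step h a b c)) ⟩
    Tail h U a b c
      ≡⟨ sym (yS⊛-suc (Tail h U) a b c) ⟩
    (yS ⊛ Tail h U) a b (suc c) ∎

module BargraphEquations where

  open import Defs
  open TrivariateSeries
  open TrivariateSeries.SeriesSolver using (solve; _:=_; _:+_; _:*_; _:-_; con)
  open Recurrences using (Tail; H-step₁; Tail-U; Tail-H; Tail-D; C≈yS⊛Tail)
  open import Algebra.Bundles using (CommutativeRing)
  open import Data.Nat as ℕ using (ℕ; suc; _≤_; _∸_; s≤s; z≤n)
  open import Data.Integer as ℤ using (+_; -1ℤ)
  open import Relation.Binary.PropositionalEquality as ≡ using (_≡_; _≢_)

  open CommutativeRing seriesRing
    using (_-_; 0#; +-cong; *-congˡ; zeroʳ; +-identityʳ) renaming (refl to ≈-refl; trans to ≈-trans)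
  open import Algebra.Properties.Ring (CommutativeRing.ring seriesRing)
    using (x≈y⇒x∙y⁻¹≈ε; x∙y⁻¹≈ε⇒x≈y)

  difference≈0 : ∀ l r → l ≈ r → l - r ≈ 0#
  difference≈0 l r = x≈y⇒x∙y⁻¹≈ε {l} {r}

  scaled≈0 : ∀ c e → e ≈ 0# → c ⊛ e ≈ 0#
  scaled≈0 c e e≈0 = ≈-trans (*-congˡ {c} {e} {0#} e≈0) (zeroʳ c)

  sum≈0 : ∀ e e′ → e ≈ 0# → e′ ≈ 0# → e ⊕ e′ ≈ 0#
  sum≈0 e e′ e≈0 e′≈0 = ≈-trans (+-cong {e} {0#} {e′} {0#} e≈0 e′≈0) (+-identityʳ 0#)

  ≈-by-remainder : ∀ l r z → l ≈ r ⊕ z → z ≈ 0# → l ≈ r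
  ≈-by-remainder l r z l≈r+z z≈0 = ≈-trans l≈r+z (≈-trans (+-cong {r} {r} {z} {0#} ≈-refl z≈0) (+-identityʳ r))

  one : Series
  one = const (+ 1)

  C-equation : ∀ h → C h ⊛ (one ⊖ H-step₁ h ⊖ H-step₁ h ⊛ C (h ∸ 1))
                     ≈ yS ⊛ ((one ⊕ H-step₁ h) ⊛ C (h ∸ 1) ⊕ H-step₁ h)
  C-equation h = ≈-by-remainder _ _ (t₁ ⊕ t₂ ⊕ t₃ ⊕ t₄ ⊕ t₅)
    (solve 8 (λ z y C A K KU KH KD →
       let o = con (+ 1) in
       C :* (o :- z :- z :* A) :=
         y :* ((o :+ z) :* A :+ z)
         :+ ((o :- z :- z :* A) :* (C :- y :* KU)
         :+ ((z :* y :* KU :+ y :* (o :+ z)) :* con -1ℤ) :* (A :- y :* K)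
         :+ (y :* (o :- z :* y :* K :- z)) :* (KU :- (y :* (K :* KD) :+ z :* KH))
         :+ (y :* (z :* y :* K :+ z)) :* (KH :- (y :* (K :* KD) :+ z :* KH :+ o))
         :+ (y :* y :* K) :* (KD :- (z :* KH :+ o))))
       ≈-refl z yS (C h) A K KU KH KD)
    (sum≈0 (t₁ ⊕ t₂ ⊕ t₃ ⊕ t₄) t₅ (sum≈0 (t₁ ⊕ t₂ ⊕ t₃) t₄ (sum≈0 (t₁ ⊕ t₂) t₃ (sum≈0 t₁ t₂
      (scaled≈0 c₁ _ (difference≈0 (C h) (yS ⊛ KU) (C≈yS⊛Tail h)))
      (scaled≈0 c₂ _ (difference≈0 A (yS ⊛ K) (C≈yS⊛Tail (h ∸ 1)))))
      (scaled≈0 c₃ _ (difference≈0 KU _ (Tail-U h))))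
      (scaled≈0 c₄ _ (difference≈0 KH _ (Tail-H h))))
      (scaled≈0 c₅ _ (difference≈0 KD _ (Tail-D h))))
    where
    z A K KU KH KD c₁ c₂ c₃ c₄ c₅ t₁ t₂ t₃ t₄ t₅ : Series
    z = H-step₁ h
    A = C (h ∸ 1)
    K = Tail (h ∸ 1) U
    KU = Tail h U
    KH = Tail h H
    KD = Tail h D
    c₁ = one ⊖ z ⊖ z ⊛ A
    c₂ = (z ⊛ yS ⊛ KU ⊕ yS ⊛ (one ⊕ z)) ⊛ const -1ℤ
    c₃ = yS ⊛ (one ⊖ z ⊛ yS ⊛ K ⊖ z)
    c₄ = yS ⊛ (z ⊛ yS ⊛ K ⊕ z)
    c₅ = yS ⊛ yS ⊛ K
    t₁ = c₁ ⊛ (C h ⊖ yS ⊛ KU)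
    t₂ = c₂ ⊛ (A ⊖ yS ⊛ K)
    t₃ = c₃ ⊛ (KU ⊖ (yS ⊛ (K ⊛ KD) ⊕ z ⊛ KH))
    t₄ = c₄ ⊛ (KH ⊖ (yS ⊛ (K ⊛ KD) ⊕ z ⊛ KH ⊕ one))
    t₅ = c₅ ⊛ (KD ⊖ (z ⊛ KH ⊕ one))

  C-recurrence : ∀ h → 2 ≤ h →
    xS ⊛ (one ⊖ xS ⊖ xS ⊛ C (h ∸ 1)) ⊛ C h ≈ yS ⊛ (one ⊖ (one ⊕ xS) ⊛ (one ⊖ xS ⊖ xS ⊛ C (h ∸ 1)))
  C-recurrence (suc (suc h)) (s≤s (s≤s z≤n)) = ≈-by-remainder _ _ (xS ⊛ (L ⊖ R))
    (solve 4 (λ x y C A →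
       let o = con (+ 1) in
       x :* (o :- x :- x :* A) :* C :=
         y :* (o :- (o :+ x) :* (o :- x :- x :* A))
         :+ x :* (C :* (o :- x :- x :* A) :- y :* ((o :+ x) :* A :+ x)))
       ≈-refl xS yS (C (2 ℕ.+ h)) (C (suc h)))
    (scaled≈0 xS (L ⊖ R) (difference≈0 L R (C-equation (2 ℕ.+ h))))
    where
    L R : Series
    L = C (2 ℕ.+ h) ⊛ (one ⊖ xS ⊖ xS ⊛ C (suc h))
    R = yS ⊛ ((one ⊕ xS) ⊛ C (suc h) ⊕ xS)

  B : Series
  B = C 0

  bargraph-quadratic : xS ⊛ B ⊛ B ⊕ (xS ⊕ yS ⊕ xS ⊛ yS ⊖ one) ⊛ B ⊕ xS ⊛ yS ≈ 0#
  bargraph-quadratic = ≈-trans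
    (solve 3 (λ x y B →
       let o = con (+ 1) in
       x :* B :* B :+ (x :+ y :+ x :* y :- o) :* B :+ x :* y :=
         con -1ℤ :* (B :* (o :- x :- x :* B) :- y :* ((o :+ x) :* B :+ x)))
       ≈-refl xS yS B)
    (scaled≈0 (const -1ℤ) (L ⊖ R) (difference≈0 L R (C-equation 0)))
    where
    L R : Series
    L = B ⊛ (one ⊖ xS ⊖ xS ⊛ B)
    R = yS ⊛ ((one ⊕ xS) ⊛ B ⊕ xS)

  -- The discriminant of the quadratic equation for B.
  Δ : Series
  Δ = (one ⊖ yS) ⊛ (one ⊖ const (+ 2) ⊛ xS ⊖ yS ⊖ const (+ 2) ⊛ xS ⊛ yS ⊕ xS ⊛ xS ⊖ xS ⊛ xS ⊛ yS)

  √Δ : Series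
  √Δ = one ⊖ xS ⊖ yS ⊖ xS ⊛ yS ⊖ const (+ 2) ⊛ xS ⊛ B

  -- (S - √Δ)(S + √Δ) = S² - Δ vanishes, and S + √Δ has constant term 2.
  √Δ-unique : ∀ S → S 0 0 0 ≡ + 1 → S ⊛ S ≈ Δ → S ≈ √Δ
  √Δ-unique S S₀≡1 S²≈Δ =
    x∙y⁻¹≈ε⇒x≈y S √Δ (⊛-nonZeroDivisor {S ⊖ √Δ} {S ⊕ √Δ} constant-term≢0 (≈-trans
    (solve 4 (λ S x y B →
       let o = con (+ 1)
           two = con (+ 2)
           Δ = (o :- y) :* (o :- two :* x :- y :- two :* x :* y :+ x :* x :- x :* x :* y)
           √Δ = o :- x :- y :- x :* y :- two :* x :* B
       in (S :- √Δ) :* (S :+ √Δ) :=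
            (S :* S :- Δ) :+ con (ℤ.- + 4) :* x :* (x :* B :* B :+ (x :+ y :+ x :* y :- o) :* B :+ x :* y))
       ≈-refl S xS yS B)
    (sum≈0 _ _ (difference≈0 (S ⊛ S) Δ S²≈Δ) (scaled≈0 (const (ℤ.- + 4) ⊛ xS) _ bargraph-quadratic))))
    where
    constant-term≢0 : (S ⊕ √Δ) 0 0 0 ≢ + 0
    constant-term≢0 rewrite S₀≡1 = λ ()

  C₁-formula : ∀ S → S 0 0 0 ≡ + 1 → S ⊛ S ≈ Δ →
    const (+ 2) ⊛ xS ⊛ (one ⊖ tS ⊕ tS ⊛ yS ⊕ (tS ⊛ tS ⊖ tS) ⊛ xS ⊛ (one ⊖ yS)) ⊛ C 1
      ≈ yS ⊛ (one ⊖ xS ⊖ yS ⊖ xS ⊛ yS ⊕ const (+ 2) ⊛ tS ⊛ (one ⊖ tS) ⊛ xS ⊛ xS ⊛ (one ⊖ yS) ⊖ S)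
  C₁-formula S S₀≡1 S²≈Δ = ≈-by-remainder _ _ (t₁ ⊕ t₂ ⊕ t₃)
    (solve 6 (λ x y t S C₁ B →
       let o = con (+ 1)
           two = con (+ 2)
       in two :* x :* (o :- t :+ t :* y :+ (t :* t :- t) :* x :* (o :- y)) :* C₁ :=
            y :* (o :- x :- y :- x :* y :+ two :* t :* (o :- t) :* x :* x :* (o :- y) :- S)
            :+ ((two :* x :* (o :- t :+ t :* y :+ t :* x :* y :+ t :* x :* B))
                  :* (C₁ :* (o :- t :* x :- t :* x :* B) :- y :* ((o :+ t :* x) :* B :+ t :* x))
            :+ (two :* x :* (t :* t :* x :* C₁ :+ y :* t :* (o :+ t :* x)))
                  :* (x :* B :* B :+ (x :+ y :+ x :* y :- o) :* B :+ x :* y)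
            :+ y :* (S :- (o :- x :- y :- x :* y :- two :* x :* B))))
       ≈-refl xS yS tS S (C 1) B)
    (sum≈0 (t₁ ⊕ t₂) t₃ (sum≈0 t₁ t₂
      (scaled≈0 c₁ _ (difference≈0 L R (C-equation 1)))
      (scaled≈0 c₂ _ bargraph-quadratic))
      (scaled≈0 yS _ (difference≈0 S √Δ (√Δ-unique S S₀≡1 S²≈Δ))))
    where
    L R c₁ c₂ t₁ t₂ t₃ : Series
    L = C 1 ⊛ (one ⊖ tS ⊛ xS ⊖ tS ⊛ xS ⊛ B)
    R = yS ⊛ ((one ⊕ tS ⊛ xS) ⊛ B ⊕ tS ⊛ xS)
    c₁ = const (+ 2) ⊛ xS ⊛ (one ⊖ tS ⊕ tS ⊛ yS ⊕ tS ⊛ xS ⊛ yS ⊕ tS ⊛ xS ⊛ B)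
    c₂ = const (+ 2) ⊛ xS ⊛ (tS ⊛ tS ⊛ xS ⊛ C 1 ⊕ yS ⊛ tS ⊛ (one ⊕ tS ⊛ xS))
    t₁ = c₁ ⊛ (L ⊖ R)
    t₂ = c₂ ⊛ (xS ⊛ B ⊛ B ⊕ (xS ⊕ yS ⊕ xS ⊛ yS ⊖ one) ⊛ B ⊕ xS ⊛ yS)
    t₃ = yS ⊛ (S ⊖ √Δ)

open import Defs
open import Data.Nat using (ℕ; _≤_; _∸_)
open import Data.Integer using (+_)
open import Data.Product using (_×_; _,_)
open import Relation.Binary.PropositionalEquality using (_≡_)

mainTheorem12 :
    ((S : Series) → S 0 0 0 ≡ + 1 →
      S ⊛ S ≈ (const (+ 1) ⊖ yS) ⊛ (const (+ 1) ⊖ const (+ 2) ⊛ xS ⊖ yS ⊖ const (+ 2) ⊛ xS ⊛ yS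
                                    ⊕ xS ⊛ xS ⊖ xS ⊛ xS ⊛ yS) →
      const (+ 2) ⊛ xS ⊛ (const (+ 1) ⊖ tS ⊕ tS ⊛ yS ⊕ (tS ⊛ tS ⊖ tS) ⊛ xS ⊛ (const (+ 1) ⊖ yS)) ⊛ C 1
        ≈ yS ⊛ (const (+ 1) ⊖ xS ⊖ yS ⊖ xS ⊛ yS
                ⊕ const (+ 2) ⊛ tS ⊛ (const (+ 1) ⊖ tS) ⊛ xS ⊛ xS ⊛ (const (+ 1) ⊖ yS)
                ⊖ S))
    ×
    ((h : ℕ) → 2 ≤ h →
      xS ⊛ (const (+ 1) ⊖ xS ⊖ xS ⊛ C (h ∸ 1)) ⊛ C h
        ≈ yS ⊛ (const (+ 1) ⊖ (const (+ 1) ⊕ xS) ⊛ (const (+ 1) ⊖ xS ⊖ xS ⊛ C (h ∸ 1))))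
mainTheorem12 = BargraphEquations.C₁-formula , BargraphEquations.C-recurrence
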